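{- Let $\Lambda$ be a symplectic lattice and let $x\in D_\Lambda$ have order $d$. The following are equivalent: (1) $x$ lies in a subgroup $D_1\subset D_\Lambda$ isomorphic to $(\mathbb{Z}/d)^{\oplus2}$ with $D_\Lambda=D_1\oplus D_1^{\perp}$; (2) $x$ lies in a subgroup $D_1\subset D_\Lambda$ isomorphic to $(\mathbb{Z}/d)^{\oplus2}$ on which the restricted form is nondegenerate; (3) there exists $y\in D_\Lambda$ such that $D_\Lambda=\langle x,y\rangle\oplus\langle x,y\rangle^{\perp}$; (4) there exists $y\in D_\Lambda$ of order $d$ with $(x,y)=1/d\in\mathbb{Q}/\mathbb{Z}$.
   Context: A symplectic lattice is a free $\mathbb{Z}$-module $\Lambda$ of finite rank with a nondegenerate alternating bilinear form $(\cdot,\cdot)\colon\Lambda\times\Lambda\to\mathbb{Z}$. $\Lambda^\vee=\{v\in\Lambda\otimes\mathbb{Q}\mid (v,\Lambda)\subset\mathbb{Z}\}$ and $D_\Lambda=\Lambda^\vee/\Lambda$ carries the nondegenerate alternating form $D_\Lambda\times D_\Lambda\to\mathbb{Q}/\mathbb{Z}$ induced by the $\mathbb{Q}$-bilinear extension of $(\cdot,\cdot)$. For a subgroup $D_1$, $D_1^\perp=\{y\in D_\Lambda\mid (y,D_1)=0\}$; a subgroup is nondegenerate if no nonzero element of it pairs trivially with the whole subgroup. -}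

module Defs where

open import Data.Nat as ℕ using (ℕ; zero; suc)
open import Data.Integer as ℤ using (ℤ; +_)
open import Data.Integer.Divisibility using (_∣_)
open import Data.Rational as ℚ using (ℚ)
open import Data.Fin using (Fin) renaming (zero to fzero; suc to fsuc)
open import Data.Product using (Σ; ∃; ∃-syntax; _×_)
open import Relation.Binary.PropositionalEquality using (_≡_)
open import Relation.Nullary using (¬_)

sumℤ : ∀ {n} → (Fin n → ℤ) → ℤ
sumℤ {zero} f = + 0
sumℤ {suc n} f = f fzero ℤ.+ sumℤ (λ i → f (fsuc i))

sumℚ : ∀ {n} → (Fin n → ℚ) → ℚ
sumℚ {zero} f = ℚ.0ℚ
sumℚ {suc n} f = f fzero ℚ.+ sumℚ (λ i → f (fsuc i))

-- Symplectic lattice: Λ = ℤⁿ (with its standard basis) carrying the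
-- bilinear form (v,w) = Σᵢⱼ vᵢ Gᵢⱼ wⱼ, required alternating and
-- nondegenerate.

formℤ : ∀ {n} → (Fin n → Fin n → ℤ) → (Fin n → ℤ) → (Fin n → ℤ) → ℤ
formℤ G v w = sumℤ (λ i → sumℤ (λ j → v i ℤ.* G i j ℤ.* w j))

record SymplecticLattice (n : ℕ) : Set where
  field
    gram        : Fin n → Fin n → ℤ
    alternating : ∀ (v : Fin n → ℤ) → formℤ gram v v ≡ + 0
    nondegenerate : ∀ (v : Fin n → ℤ) →
                    (∀ (w : Fin n → ℤ) → formℤ gram v w ≡ + 0) →
                    ∀ i → v i ≡ + 0

Vecℚ : ℕ → Set
Vecℚ n = Fin n → ℚ

IsInt : ℚ → Set
IsInt q = ∃[ z ] q ≡ z ℚ./ 1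

embed : ∀ {n} → (Fin n → ℤ) → Vecℚ n
embed w i = w i ℚ./ 1

_+ᵥ_ : ∀ {n} → Vecℚ n → Vecℚ n → Vecℚ n
(v +ᵥ w) i = v i ℚ.+ w i

-ᵥ_ : ∀ {n} → Vecℚ n → Vecℚ n
(-ᵥ v) i = ℚ.- v i

_·ᵥ_ : ∀ {n} → ℤ → Vecℚ n → Vecℚ n
(k ·ᵥ v) i = (k ℚ./ 1) ℚ.* v i

0ᵥ : ∀ {n} → Vecℚ n
0ᵥ i = ℚ.0ℚ

module _ {n : ℕ} (L : SymplecticLattice n) where
  open SymplecticLattice L

  ⟪_,_⟫ : Vecℚ n → Vecℚ n → ℚ
  ⟪ v , w ⟫ = sumℚ (λ i → sumℚ (λ j → v i ℚ.* (gram i j ℚ./ 1) ℚ.* w j))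

  InDual : Vecℚ n → Set
  InDual v = ∀ (w : Fin n → ℤ) → IsInt ⟪ v , embed w ⟫

  -- equality in D_Λ = Λ^∨/Λ : difference lies in Λ
  _≈_ : Vecℚ n → Vecℚ n → Set
  v ≈ w = ∀ i → IsInt (v i ℚ.- w i)

  -- subgroups of D_Λ, as predicates on Λ^∨ compatible with ≈
  record Subgroup : Set₁ where
    field
      Mem     : Vecℚ n → Set
      ⊆dual   : ∀ v → Mem v → InDual v
      resp    : ∀ v w → v ≈ w → Mem v → Mem w
      has0    : Mem 0ᵥ
      closed+ : ∀ v w → Mem v → Mem w → Mem (v +ᵥ w)
      closed- : ∀ v → Mem v → Mem (-ᵥ v)

  -- orthogonal complement D₁^⊥ inside D_Λ (pairing zero in ℚ/ℤ)
  Perp : (Vecℚ n → Set) → Vecℚ n → Set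
  Perp P y = InDual y × (∀ z → P z → IsInt ⟪ y , z ⟫)

  DirectSumWithPerp : (Vecℚ n → Set) → Set
  DirectSumWithPerp P =
    (∀ v → InDual v → ∃[ a ] ∃[ b ] (P a × Perp P b × v ≈ (a +ᵥ b)))
    × (∀ v → P v → Perp P v → v ≈ 0ᵥ)

  NondegOn : (Vecℚ n → Set) → Set
  NondegOn P = ∀ v → P v → (∀ w → P w → IsInt ⟪ v , w ⟫) → v ≈ 0ᵥ

  -- D₁ ≅ (ℤ/d)^{⊕2}: a bijective homomorphism (ℤ/d)² → D₁, where
  -- (ℤ/d)² is presented as ℤ × ℤ modulo d
  IsoZmod²  : ℕ → Subgroup → Set
  IsoZmod² d D₁ =
    Σ (ℤ → ℤ → Vecℚ n) λ f →
      (∀ i j → Mem (f i j))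
    × (∀ i j i′ j′ → f (i ℤ.+ i′) (j ℤ.+ j′) ≈ (f i j +ᵥ f i′ j′))
    × (∀ i j i′ j′ → (+ d) ∣ (i ℤ.- i′) → (+ d) ∣ (j ℤ.- j′) → f i j ≈ f i′ j′)
    × (∀ i j i′ j′ → f i j ≈ f i′ j′ → ((+ d) ∣ (i ℤ.- i′)) × ((+ d) ∣ (j ℤ.- j′)))
    × (∀ v → Mem v → ∃[ i ] ∃[ j ] v ≈ f i j)
    where open Subgroup D₁

  HasOrder : Vecℚ n → ℕ → Set
  HasOrder x d = (1 ℕ.≤ d) × ((+ d) ·ᵥ x) ≈ 0ᵥ
               × (∀ k → 1 ℕ.≤ k → k ℕ.< d → ¬ (((+ k) ·ᵥ x) ≈ 0ᵥ))

  Gen : Vecℚ n → Vecℚ n → Vecℚ n → Set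
  Gen x y v = InDual v × ∃[ i ] ∃[ j ] v ≈ ((i ·ᵥ x) +ᵥ (j ·ᵥ y))

-- 1/d ∈ ℚ (only used for d ≥ 1; the value at 0 is irrelevant)
recip : ℕ → ℚ
recip zero = ℚ.0ℚ
recip (suc m) = + 1 ℚ./ suc m

-- Read the ℚ-valued pairing modulo ℤ.  If (x, y) = 1/d and dx = dy = 0, then
-- (x, ix + jy) = j/d and (ix + jy, y) = i/d, so ix + jy determines (i, j) modulo d:
-- ⟨x, y⟩ ≅ (ℤ/d)², the form is nondegenerate on it, and any v with (v, x) = σ/d,
-- (v, y) = τ/d splits as (τx − σy) + (v − τx + σy), the second summand being
-- orthogonal to x and y.  This gives (4) ⇒ (1) and (4) ⇒ (3).  Conversely, under (2)
-- or (3) x lies in a d-torsion subgroup spanned by some y₁, y₂ in which no kx with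
-- 0 < k < d is orthogonal to both y₁ and y₂.  Writing (x, y₁) = α/d and (x, y₂) = β/d,
-- this says gcd(α, β, d) = 1, so a Bézout combination y = iy₁ + jy₂ has (x, y) = 1/d,
-- which forces y to have order d.

module Submission where

open import Algebra.Bundles using (CommutativeRing)
import Algebra.Properties.Semiring.Sum as Sum
open import Data.Empty using (⊥; ⊥-elim)
open import Data.Fin using (Fin) renaming (zero to fzero; suc to fsuc)
open import Data.Integer as ℤ using (ℤ; +_; +[1+_]; -[1+_])
import Data.Integer.Divisibility as Unsigned
open import Data.Integer.Divisibility.Signed using (_∣_; divides; ∣ᵤ⇒∣; ∣⇒∣ᵤ; m∣∣m∣; *-monoʳ-∣)
import Data.Integer.Properties as ℤ
open import Data.Integer.Tactic.RingSolver using () renaming (solve-∀ to solveℤ-∀)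
open import Data.Nat as ℕ using (ℕ; zero; suc)
import Data.Nat.Divisibility as ℕ
open import Data.Nat.GCD using (gcd; gcd[m,n]∣m; gcd[m,n]∣n; gcd-GCD; module Bézout)
import Data.Nat.Properties as ℕ
open import Data.Product using (∃₂; ∃-syntax; _×_; _,_; proj₁; proj₂)
open import Data.Rational as ℚ using (ℚ; 0ℚ; 1ℚ; _-_)
import Data.Rational.Properties as ℚ
open import Data.Rational.Unnormalised as ℚᵘ using (mkℚᵘ; *≡*)
import Data.Rational.Unnormalised.Properties as ℚᵘ
import Data.Vec.Functional.Relation.Binary.Equality.Setoid as PointwiseSetoid
open import Function.Base using (_∘_)
open import Function.Bundles using (_⇔_; mk⇔)
open import Level using (0ℓ)
open import Relation.Binary.Bundles using (Setoid)
open import Relation.Binary.PropositionalEquality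
  using (_≡_; refl; sym; trans; cong; cong₂; subst; _≗_; module ≡-Reasoning)
import Relation.Binary.Reasoning.Setoid as SetoidReasoning
open import Relation.Nullary using (¬_)
open import Relation.Nullary.Decidable.Core using (dec⇒maybe)
open import Tactic.RingSolver using (solve-∀)
open import Tactic.RingSolver.Core.AlmostCommutativeRing using (AlmostCommutativeRing; fromCommutativeRing)

open import Defs

ℚ-ring : AlmostCommutativeRing 0ℓ 0ℓ
ℚ-ring = fromCommutativeRing ℚ.+-*-commutativeRing (λ p → dec⇒maybe (0ℚ ℚ.≟ p))

ι : ℤ → ℚ
ι z = z ℚ./ 1

toℚᵘ-ι : ∀ z → ℚ.toℚᵘ (ι z) ℚᵘ.≃ mkℚᵘ z 0
toℚᵘ-ι z = ℚ.toℚᵘ-fromℚᵘ (mkℚᵘ z 0)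

ι-+ : ∀ a b → ι (a ℤ.+ b) ≡ ι a ℚ.+ ι b
ι-+ a b = ℚ.toℚᵘ-injective (begin
  ℚ.toℚᵘ (ι (a ℤ.+ b))             ≈⟨ toℚᵘ-ι (a ℤ.+ b) ⟩
  mkℚᵘ (a ℤ.+ b) 0                 ≈⟨ *≡* (cross a b) ⟩
  mkℚᵘ a 0 ℚᵘ.+ mkℚᵘ b 0           ≈⟨ ℚᵘ.+-cong (toℚᵘ-ι a) (toℚᵘ-ι b) ⟨
  ℚ.toℚᵘ (ι a) ℚᵘ.+ ℚ.toℚᵘ (ι b)   ≈⟨ ℚ.toℚᵘ-homo-+ (ι a) (ι b) ⟨
  ℚ.toℚᵘ (ι a ℚ.+ ι b)             ∎)
  where
  open ℚᵘ.≃-Reasoning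
  cross : ∀ a b → (a ℤ.+ b) ℤ.* + 1 ≡ (a ℤ.* + 1 ℤ.+ b ℤ.* + 1) ℤ.* + 1
  cross = solveℤ-∀

ι-* : ∀ a b → ι (a ℤ.* b) ≡ ι a ℚ.* ι b
ι-* a b = ℚ.toℚᵘ-injective (begin
  ℚ.toℚᵘ (ι (a ℤ.* b))             ≈⟨ toℚᵘ-ι (a ℤ.* b) ⟩
  mkℚᵘ (a ℤ.* b) 0                 ≈⟨ *≡* refl ⟩
  mkℚᵘ a 0 ℚᵘ.* mkℚᵘ b 0           ≈⟨ ℚᵘ.*-cong (toℚᵘ-ι a) (toℚᵘ-ι b) ⟨
  ℚ.toℚᵘ (ι a) ℚᵘ.* ℚ.toℚᵘ (ι b)   ≈⟨ ℚ.toℚᵘ-homo-* (ι a) (ι b) ⟨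
  ℚ.toℚᵘ (ι a ℚ.* ι b)             ∎)
  where open ℚᵘ.≃-Reasoning

ι-neg : ∀ a → ι (ℤ.- a) ≡ ℚ.- ι a
ι-neg (+ zero)  = refl
ι-neg +[1+ n ]  = refl
ι-neg -[1+ n ]  = involutive (ι (+ suc n))
  where
  involutive : ∀ p → p ≡ ℚ.- (ℚ.- p)
  involutive = solve-∀ ℚ-ring

ι-sub : ∀ a b → ι (a ℤ.- b) ≡ ι a - ι b
ι-sub a b = trans (ι-+ a (ℤ.- b)) (cong (ι a ℚ.+_) (ι-neg b))

ι-injective : ∀ {a b} → ι a ≡ ι b → a ≡ b
ι-injective {a} {b} eq with ℚᵘ.≃-trans (ℚᵘ.≃-sym (toℚᵘ-ι a)) (ℚᵘ.≃-trans (ℚ.toℚᵘ-cong eq) (toℚᵘ-ι b))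
... | *≡* a*1≡b*1 = trans (sym (ℤ.*-identityʳ a)) (trans a*1≡b*1 (ℤ.*-identityʳ b))

isInt-+ : ∀ {p q} → IsInt p → IsInt q → IsInt (p ℚ.+ q)
isInt-+ (a , refl) (b , refl) = a ℤ.+ b , sym (ι-+ a b)

isInt-neg : ∀ {p} → IsInt p → IsInt (ℚ.- p)
isInt-neg (a , refl) = ℤ.- a , sym (ι-neg a)

isInt-ι* : ∀ k {p} → IsInt p → IsInt (ι k ℚ.* p)
isInt-ι* k (a , refl) = k ℤ.* a , sym (ι-* k a)

-- A record rather than a function, so that both sides can be inferred from a proof.
infix 4 _≈ᶻ_
record _≈ᶻ_ (p q : ℚ) : Set where
  constructor mod1
  field integral : IsInt (p - q)
open _≈ᶻ_ public

≈ᶻ-reflexive : ∀ {p q} → p ≡ q → p ≈ᶻ q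
≈ᶻ-reflexive {p} refl = mod1 (+ 0 , ℚ.+-inverseʳ p)

≈ᶻ-sym : ∀ {p q} → p ≈ᶻ q → q ≈ᶻ p
≈ᶻ-sym {p} {q} (mod1 h) = mod1 (subst IsInt (flip p q) (isInt-neg h))
  where
  flip : ∀ p q → ℚ.- (p - q) ≡ q - p
  flip = solve-∀ ℚ-ring

≈ᶻ-trans : ∀ {p q r} → p ≈ᶻ q → q ≈ᶻ r → p ≈ᶻ r
≈ᶻ-trans {p} {q} {r} (mod1 h) (mod1 h′) = mod1 (subst IsInt (telescope p q r) (isInt-+ h h′))
  where
  telescope : ∀ p q r → (p - q) ℚ.+ (q - r) ≡ p - r
  telescope = solve-∀ ℚ-ring

≈ᶻ-setoid : Setoid 0ℓ 0ℓ
≈ᶻ-setoid = record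
  { Carrier = ℚ
  ; _≈_ = _≈ᶻ_
  ; isEquivalence = record { refl = ≈ᶻ-reflexive refl ; sym = ≈ᶻ-sym ; trans = ≈ᶻ-trans }
  }

module ≈ᶻ-Reasoning = SetoidReasoning ≈ᶻ-setoid
open PointwiseSetoid ≈ᶻ-setoid using (_≋_; ≋-refl; ≋-sym; ≋-trans; ≋-setoid)

+-congᶻ : ∀ {p p′ q q′} → p ≈ᶻ p′ → q ≈ᶻ q′ → p ℚ.+ q ≈ᶻ p′ ℚ.+ q′
+-congᶻ {p} {p′} {q} {q′} (mod1 h) (mod1 h′) = mod1 (subst IsInt (regroup p p′ q q′) (isInt-+ h h′))
  where
  regroup : ∀ p p′ q q′ → (p - p′) ℚ.+ (q - q′) ≡ (p ℚ.+ q) - (p′ ℚ.+ q′)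
  regroup = solve-∀ ℚ-ring

+-congˡᶻ : ∀ r {p q} → p ≈ᶻ q → r ℚ.+ p ≈ᶻ r ℚ.+ q
+-congˡᶻ r = +-congᶻ (≈ᶻ-reflexive {r} refl)

+-congʳᶻ : ∀ r {p q} → p ≈ᶻ q → p ℚ.+ r ≈ᶻ q ℚ.+ r
+-congʳᶻ r p≈ᶻq = +-congᶻ p≈ᶻq (≈ᶻ-reflexive {r} refl)

-‿congᶻ : ∀ {p q} → p ≈ᶻ q → ℚ.- p ≈ᶻ ℚ.- q
-‿congᶻ {p} {q} (mod1 h) = mod1 (subst IsInt (regroup p q) (isInt-neg h))
  where
  regroup : ∀ p q → ℚ.- (p - q) ≡ ℚ.- p - ℚ.- q
  regroup = solve-∀ ℚ-ring

ι*-congᶻ : ∀ k {p q} → p ≈ᶻ q → ι k ℚ.* p ≈ᶻ ι k ℚ.* q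
ι*-congᶻ k {p} {q} (mod1 h) = mod1 (subst IsInt (distrib (ι k) p q) (isInt-ι* k h))
  where
  distrib : ∀ c p q → c ℚ.* (p - q) ≡ c ℚ.* p - c ℚ.* q
  distrib = solve-∀ ℚ-ring

isInt⇒≈ᶻ0 : ∀ {p} → IsInt p → p ≈ᶻ 0ℚ
isInt⇒≈ᶻ0 {p} h = mod1 (subst IsInt (sym (ℚ.+-identityʳ p)) h)

≈ᶻ0⇒isInt : ∀ {p} → p ≈ᶻ 0ℚ → IsInt p
≈ᶻ0⇒isInt {p} (mod1 h) = subst IsInt (ℚ.+-identityʳ p) h

ι*-sub : ∀ a b p → ι a ℚ.* p - ι b ℚ.* p ≡ ι (a ℤ.- b) ℚ.* p
ι*-sub a b p = trans (factor (ι a) (ι b) p) (cong (ℚ._* p) (sym (ι-sub a b)))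
  where
  factor : ∀ x y p → x ℚ.* p - y ℚ.* p ≡ (x - y) ℚ.* p
  factor = solve-∀ ℚ-ring

ι*recip≡1 : ∀ m → ι (+ suc m) ℚ.* recip (suc m) ≡ 1ℚ
ι*recip≡1 m = ℚ.toℚᵘ-injective (begin
  ℚ.toℚᵘ (ι d ℚ.* recip (suc m))                ≈⟨ ℚ.toℚᵘ-homo-* (ι d) (recip (suc m)) ⟩
  ℚ.toℚᵘ (ι d) ℚᵘ.* ℚ.toℚᵘ (recip (suc m))      ≈⟨ ℚᵘ.*-cong (toℚᵘ-ι d) (ℚ.toℚᵘ-fromℚᵘ (mkℚᵘ (+ 1) m)) ⟩
  mkℚᵘ d 0 ℚᵘ.* mkℚᵘ (+ 1) m                    ≈⟨ *≡* cross ⟩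
  ℚ.toℚᵘ 1ℚ                                     ∎)
  where
  open ℚᵘ.≃-Reasoning
  d = + suc m
  cross : (d ℤ.* + 1) ℤ.* + 1 ≡ + 1 ℤ.* + suc (ℕ.pred (1 ℕ.* suc m))
  cross = trans (ℤ.*-identityʳ _) (trans (ℤ.*-identityʳ _)
            (trans (cong +_ (sym (ℕ.*-identityˡ (suc m)))) (sym (ℤ.*-identityˡ _))))

-- d = suc m, so that recip d really is 1/d.
module _ (m : ℕ) where
  private
    d : ℤ
    d = + suc m
    r : ℚ
    r = recip (suc m)

  ι*≡⇒≡*recip : ∀ p {q} → ι d ℚ.* p ≡ q → p ≡ q ℚ.* r
  ι*≡⇒≡*recip p refl = begin
    p                    ≡⟨ ℚ.*-identityʳ p ⟨
    p ℚ.* 1ℚ             ≡⟨ cong (p ℚ.*_) (ι*recip≡1 m) ⟨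
    p ℚ.* (ι d ℚ.* r)    ≡⟨ reassoc p (ι d) r ⟩
    ι d ℚ.* p ℚ.* r      ∎
    where
    open ≡-Reasoning
    reassoc : ∀ p c r → p ℚ.* (c ℚ.* r) ≡ c ℚ.* p ℚ.* r
    reassoc = solve-∀ ℚ-ring

  ∣⇒*recip≈ᶻ : ∀ {a b} → d ∣ a ℤ.- b → ι a ℚ.* r ≈ᶻ ι b ℚ.* r
  ∣⇒*recip≈ᶻ {a} {b} (divides q a-b≡q*d) = mod1 (q , (begin
    ι a ℚ.* r - ι b ℚ.* r     ≡⟨ ι*-sub a b r ⟩
    ι (a ℤ.- b) ℚ.* r         ≡⟨ cong (λ z → ι z ℚ.* r) a-b≡q*d ⟩
    ι (q ℤ.* d) ℚ.* r         ≡⟨ cong (ℚ._* r) (ι-* q d) ⟩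
    ι q ℚ.* ι d ℚ.* r         ≡⟨ ℚ.*-assoc (ι q) (ι d) r ⟩
    ι q ℚ.* (ι d ℚ.* r)       ≡⟨ cong (ι q ℚ.*_) (ι*recip≡1 m) ⟩
    ι q ℚ.* 1ℚ                ≡⟨ ℚ.*-identityʳ (ι q) ⟩
    ι q                       ∎))
    where open ≡-Reasoning

  *recip≈ᶻ⇒∣ : ∀ {a b} → ι a ℚ.* r ≈ᶻ ι b ℚ.* r → d ∣ a ℤ.- b
  *recip≈ᶻ⇒∣ {a} {b} (mod1 (z , eq)) = divides z (ι-injective (begin
    ι (a ℤ.- b)                     ≡⟨ ℚ.*-identityʳ _ ⟨
    ι (a ℤ.- b) ℚ.* 1ℚ              ≡⟨ cong (ι (a ℤ.- b) ℚ.*_) (ι*recip≡1 m) ⟨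
    ι (a ℤ.- b) ℚ.* (ι d ℚ.* r)     ≡⟨ reassoc (ι (a ℤ.- b)) (ι d) r ⟩
    ι (a ℤ.- b) ℚ.* r ℚ.* ι d       ≡⟨ cong (ℚ._* ι d) (ι*-sub a b r) ⟨
    (ι a ℚ.* r - ι b ℚ.* r) ℚ.* ι d ≡⟨ cong (ℚ._* ι d) eq ⟩
    ι z ℚ.* ι d                     ≡⟨ ι-* z d ⟨
    ι (z ℤ.* d)                     ∎))
    where
    open ≡-Reasoning
    reassoc : ∀ p c r → p ℚ.* (c ℚ.* r) ≡ p ℚ.* r ℚ.* c
    reassoc = solve-∀ ℚ-ring

  *recip≈ᶻ0⇒∣ : ∀ a → ι a ℚ.* r ≈ᶻ 0ℚ → d ∣ a
  *recip≈ᶻ0⇒∣ a a/d≈ᶻ0 = subst (d ∣_) (ℤ.+-identityʳ a)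
    (*recip≈ᶻ⇒∣ {a} {+ 0} (≈ᶻ-trans a/d≈ᶻ0 (≈ᶻ-reflexive (sym (ℚ.*-zeroˡ r)))))

  ∣⇒*recip≈ᶻ0 : ∀ a → d ∣ a → ι a ℚ.* r ≈ᶻ 0ℚ
  ∣⇒*recip≈ᶻ0 a d∣a = ≈ᶻ-trans (∣⇒*recip≈ᶻ {a} {+ 0} (subst (d ∣_) (sym (ℤ.+-identityʳ a)) d∣a))
                                (≈ᶻ-reflexive (ℚ.*-zeroˡ r))

-- Vectors of Λ ⊗ ℚ modulo Λ

lincomb : ∀ {n} → ℤ → ℤ → Vecℚ n → Vecℚ n → Vecℚ n
lincomb i j a b = (i ·ᵥ a) +ᵥ (j ·ᵥ b)

≗⇒≋ : ∀ {n} {v w : Vecℚ n} → v ≗ w → v ≋ w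
≗⇒≋ v≗w t = ≈ᶻ-reflexive (v≗w t)

+ᵥ-cong : ∀ {n} {a a′ b b′ : Vecℚ n} → a ≋ a′ → b ≋ b′ → a +ᵥ b ≋ a′ +ᵥ b′
+ᵥ-cong a≋a′ b≋b′ t = +-congᶻ (a≋a′ t) (b≋b′ t)

-ᵥ-cong : ∀ {n} {a a′ : Vecℚ n} → a ≋ a′ → -ᵥ a ≋ -ᵥ a′
-ᵥ-cong a≋a′ t = -‿congᶻ (a≋a′ t)

lincomb-+ : ∀ {n} i j i′ j′ (a b : Vecℚ n) → lincomb i j a b +ᵥ lincomb i′ j′ a b ≗ lincomb (i ℤ.+ i′) (j ℤ.+ j′) a b
lincomb-+ i j i′ j′ a b t = trans (regroup (ι i) (ι i′) (ι j) (ι j′) (a t) (b t))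
  (sym (cong₂ (λ p q → p ℚ.* a t ℚ.+ q ℚ.* b t) (ι-+ i i′) (ι-+ j j′)))
  where
  regroup : ∀ c c′ e e′ p q → (c ℚ.* p ℚ.+ e ℚ.* q) ℚ.+ (c′ ℚ.* p ℚ.+ e′ ℚ.* q) ≡ (c ℚ.+ c′) ℚ.* p ℚ.+ (e ℚ.+ e′) ℚ.* q
  regroup = solve-∀ ℚ-ring

lincomb-neg : ∀ {n} i j (a b : Vecℚ n) → -ᵥ lincomb i j a b ≗ lincomb (ℤ.- i) (ℤ.- j) a b
lincomb-neg i j a b t = trans (negate (ι i) (ι j) (a t) (b t))
  (sym (cong₂ (λ p q → p ℚ.* a t ℚ.+ q ℚ.* b t) (ι-neg i) (ι-neg j)))
  where
  negate : ∀ c e p q → ℚ.- (c ℚ.* p ℚ.+ e ℚ.* q) ≡ (ℚ.- c) ℚ.* p ℚ.+ (ℚ.- e) ℚ.* q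
  negate = solve-∀ ℚ-ring

·ᵥ-as-lincombˡ : ∀ {n} k (a b : Vecℚ n) → k ·ᵥ a ≗ lincomb k (+ 0) a b
·ᵥ-as-lincombˡ k a b t = pad (ι k) (a t) (b t)
  where
  pad : ∀ c p q → c ℚ.* p ≡ c ℚ.* p ℚ.+ 0ℚ ℚ.* q
  pad = solve-∀ ℚ-ring

·ᵥ-as-lincombʳ : ∀ {n} k (a b : Vecℚ n) → k ·ᵥ b ≗ lincomb (+ 0) k a b
·ᵥ-as-lincombʳ k a b t = pad (ι k) (a t) (b t)
  where
  pad : ∀ c p q → c ℚ.* q ≡ 0ℚ ℚ.* p ℚ.+ c ℚ.* q
  pad = solve-∀ ℚ-ring

lincomb-zero : ∀ {n} (a b : Vecℚ n) → lincomb (+ 0) (+ 0) a b ≗ 0ᵥ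
lincomb-zero a b t = annihilate (a t) (b t)
  where
  annihilate : ∀ p q → 0ℚ ℚ.* p ℚ.+ 0ℚ ℚ.* q ≡ 0ℚ
  annihilate = solve-∀ ℚ-ring

·ᵥ-∣-torsion : ∀ {n d k} {v : Vecℚ n} → d ∣ k → (d ·ᵥ v) ≋ 0ᵥ → (k ·ᵥ v) ≋ 0ᵥ
·ᵥ-∣-torsion {d = d} {v = v} (divides q refl) dv≋0 t = begin
  ι (q ℤ.* d) ℚ.* v t      ≡⟨ cong (ℚ._* v t) (ι-* q d) ⟩
  ι q ℚ.* ι d ℚ.* v t      ≡⟨ ℚ.*-assoc (ι q) (ι d) (v t) ⟩
  ι q ℚ.* (ι d ℚ.* v t)    ≈⟨ ι*-congᶻ q (dv≋0 t) ⟩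
  ι q ℚ.* 0ℚ               ≡⟨ ℚ.*-zeroʳ (ι q) ⟩
  0ℚ                       ∎
  where open ≈ᶻ-Reasoning

lincomb-torsion : ∀ {n} d i j {a b : Vecℚ n} → (d ·ᵥ a) ≋ 0ᵥ → (d ·ᵥ b) ≋ 0ᵥ → (d ·ᵥ lincomb i j a b) ≋ 0ᵥ
lincomb-torsion d i j {a} {b} da≋0 db≋0 t = begin
  ι d ℚ.* (ι i ℚ.* a t ℚ.+ ι j ℚ.* b t)        ≡⟨ distrib (ι d) (ι i) (ι j) (a t) (b t) ⟩
  ι i ℚ.* (ι d ℚ.* a t) ℚ.+ ι j ℚ.* (ι d ℚ.* b t) ≈⟨ +-congᶻ (ι*-congᶻ i (da≋0 t)) (ι*-congᶻ j (db≋0 t)) ⟩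
  ι i ℚ.* 0ℚ ℚ.+ ι j ℚ.* 0ℚ                    ≡⟨ annihilate (ι i) (ι j) ⟩
  0ℚ                                           ∎
  where
  open ≈ᶻ-Reasoning
  distrib : ∀ c e e′ p q → c ℚ.* (e ℚ.* p ℚ.+ e′ ℚ.* q) ≡ e ℚ.* (c ℚ.* p) ℚ.+ e′ ℚ.* (c ℚ.* q)
  distrib = solve-∀ ℚ-ring
  annihilate : ∀ e e′ → e ℚ.* 0ℚ ℚ.+ e′ ℚ.* 0ℚ ≡ 0ℚ
  annihilate = solve-∀ ℚ-ring

additive⇒linear : (h : ℤ → ℚ) → (∀ a b → h (a ℤ.+ b) ≈ᶻ h a ℚ.+ h b) → ∀ a → h a ≈ᶻ ι a ℚ.* h (+ 1)
additive⇒linear h additive = linear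
  where
  open ≈ᶻ-Reasoning
  h0≈ᶻ0 : h (+ 0) ≈ᶻ 0ℚ
  h0≈ᶻ0 = begin
    h (+ 0)                            ≡⟨ cancel (h (+ 0)) ⟩
    (h (+ 0) ℚ.+ h (+ 0)) - h (+ 0)    ≈⟨ +-congʳᶻ (ℚ.- h (+ 0)) (additive (+ 0) (+ 0)) ⟨
    h (+ 0) - h (+ 0)                  ≡⟨ ℚ.+-inverseʳ (h (+ 0)) ⟩
    0ℚ                                 ∎
    where
    cancel : ∀ p → p ≡ (p ℚ.+ p) - p
    cancel = solve-∀ ℚ-ring
  positive : ∀ k → h (+ k) ≈ᶻ ι (+ k) ℚ.* h (+ 1)
  positive zero    = ≈ᶻ-trans h0≈ᶻ0 (≈ᶻ-reflexive (sym (ℚ.*-zeroˡ (h (+ 1)))))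
  positive (suc k) = begin
    h (+ suc k)                              ≈⟨ additive (+ 1) (+ k) ⟩
    h (+ 1) ℚ.+ h (+ k)                      ≈⟨ +-congˡᶻ (h (+ 1)) (positive k) ⟩
    h (+ 1) ℚ.+ ι (+ k) ℚ.* h (+ 1)          ≡⟨ collect (ι (+ k)) (h (+ 1)) ⟩
    (1ℚ ℚ.+ ι (+ k)) ℚ.* h (+ 1)             ≡⟨ cong (ℚ._* h (+ 1)) (ι-+ (+ 1) (+ k)) ⟨
    ι (+ suc k) ℚ.* h (+ 1)                  ∎
    where
    collect : ∀ c p → p ℚ.+ c ℚ.* p ≡ (1ℚ ℚ.+ c) ℚ.* p
    collect = solve-∀ ℚ-ring
  linear : ∀ a → h a ≈ᶻ ι a ℚ.* h (+ 1)
  linear (+ k)     = positive k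
  linear -[1+ k ]  = begin
    h -[1+ k ]                                        ≡⟨ isolate (h -[1+ k ]) (h (+ suc k)) ⟩
    (h -[1+ k ] ℚ.+ h (+ suc k)) - h (+ suc k)        ≈⟨ +-congʳᶻ (ℚ.- h (+ suc k)) (additive -[1+ k ] (+ suc k)) ⟨
    h (-[1+ k ] ℤ.+ + suc k) - h (+ suc k)            ≡⟨ cong (λ z → h z - h (+ suc k)) (ℤ.+-inverseˡ (+ suc k)) ⟩
    h (+ 0) - h (+ suc k)                             ≈⟨ +-congᶻ h0≈ᶻ0 (-‿congᶻ (positive (suc k))) ⟩
    0ℚ - ι (+ suc k) ℚ.* h (+ 1)                      ≡⟨ negate (ι (+ suc k)) (h (+ 1)) ⟩
    ℚ.- ι (+ suc k) ℚ.* h (+ 1)                       ≡⟨ cong (ℚ._* h (+ 1)) (ι-neg (+ suc k)) ⟨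
    ι -[1+ k ] ℚ.* h (+ 1)                            ∎
    where
    isolate : ∀ p q → p ≡ (p ℚ.+ q) - q
    isolate = solve-∀ ℚ-ring
    negate : ∀ c p → 0ℚ - c ℚ.* p ≡ ℚ.- c ℚ.* p
    negate = solve-∀ ℚ-ring

biadditive⇒lincomb : ∀ {n} (f : ℤ → ℤ → Vecℚ n) →
  (∀ i j i′ j′ → f (i ℤ.+ i′) (j ℤ.+ j′) ≋ f i j +ᵥ f i′ j′) →
  ∀ i j → f i j ≋ lincomb i j (f (+ 1) (+ 0)) (f (+ 0) (+ 1))
biadditive⇒lincomb f additive i j t = begin
  f i j t                                                 ≡⟨ cong₂ (λ a b → f a b t) (ℤ.+-identityʳ i) (ℤ.+-identityˡ j) ⟨
  f (i ℤ.+ + 0) (+ 0 ℤ.+ j) t                             ≈⟨ additive i (+ 0) (+ 0) j t ⟩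
  f i (+ 0) t ℚ.+ f (+ 0) j t                             ≈⟨ +-congᶻ (first i) (second j) ⟩
  ι i ℚ.* f (+ 1) (+ 0) t ℚ.+ ι j ℚ.* f (+ 0) (+ 1) t     ∎
  where
  open ≈ᶻ-Reasoning
  first : ∀ a → f a (+ 0) t ≈ᶻ ι a ℚ.* f (+ 1) (+ 0) t
  first = additive⇒linear (λ a → f a (+ 0) t) (λ a b → additive a (+ 0) b (+ 0) t)
  second : ∀ b → f (+ 0) b t ≈ᶻ ι b ℚ.* f (+ 0) (+ 1) t
  second = additive⇒linear (λ b → f (+ 0) b t) (λ a b → additive (+ 0) a (+ 0) b t)

-- Elementary number theory

private
  ℕ-identity⇒ℤ : ∀ g y b x a → g ℕ.+ y ℕ.* b ≡ x ℕ.* a → + x ℤ.* + a ℤ.+ ℤ.- + y ℤ.* + b ≡ + g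
  ℕ-identity⇒ℤ g y b x a eq = begin
    + x ℤ.* + a ℤ.+ ℤ.- + y ℤ.* + b               ≡⟨ cong (λ z → z ℤ.+ ℤ.- + y ℤ.* + b) lifted ⟨
    + g ℤ.+ + y ℤ.* + b ℤ.+ ℤ.- + y ℤ.* + b       ≡⟨ cancel (+ g) (+ y) (+ b) ⟩
    + g                                           ∎
    where
    open ≡-Reasoning
    lifted : + g ℤ.+ + y ℤ.* + b ≡ + x ℤ.* + a
    lifted = trans (cong (λ z → + g ℤ.+ z) (sym (ℤ.pos-* y b)))
               (trans (sym (ℤ.pos-+ g (y ℕ.* b))) (trans (cong +_ eq) (ℤ.pos-* x a)))
    cancel : ∀ g y b → g ℤ.+ y ℤ.* b ℤ.+ ℤ.- y ℤ.* b ≡ g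
    cancel = solveℤ-∀

bézout-ℤ : ∀ a b → ∃₂ λ u v → u ℤ.* + a ℤ.+ v ℤ.* + b ≡ + gcd a b
bézout-ℤ a b with Bézout.identity (gcd-GCD a b)
... | Bézout.+- x y eq = + x , ℤ.- + y , ℕ-identity⇒ℤ (gcd a b) y b x a eq
... | Bézout.-+ x y eq = ℤ.- + x , + y , trans (ℤ.+-comm (ℤ.- + x ℤ.* + a) (+ y ℤ.* + b)) (ℕ-identity⇒ℤ (gcd a b) x a y b eq)

gcd₃≡1⇒combination : ∀ d α β → gcd (gcd ℤ.∣ α ∣ ℤ.∣ β ∣) d ≡ 1 →
                     ∃₂ λ i j → + d ∣ i ℤ.* α ℤ.+ j ℤ.* β ℤ.- + 1
gcd₃≡1⇒combination d α β gcd≡1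
  with bézout-ℤ ℤ.∣ α ∣ ℤ.∣ β ∣ | bézout-ℤ (gcd ℤ.∣ α ∣ ℤ.∣ β ∣) d | m∣∣m∣ {α} | m∣∣m∣ {β}
... | u , v , uα+vβ≡g₁ | p , w , pg₁+wd≡g | divides sα ∣α∣≡sαα | divides sβ ∣β∣≡sββ =
  p ℤ.* u ℤ.* sα , p ℤ.* v ℤ.* sβ , divides (ℤ.- w) (begin
    p ℤ.* u ℤ.* sα ℤ.* α ℤ.+ p ℤ.* v ℤ.* sβ ℤ.* β ℤ.- + 1
      ≡⟨ regroup p u sα α v sβ β ⟩
    p ℤ.* (u ℤ.* (sα ℤ.* α) ℤ.+ v ℤ.* (sβ ℤ.* β)) ℤ.- + 1
      ≡⟨ cong (λ z → p ℤ.* z ℤ.- + 1) (cong₂ (λ s t → u ℤ.* s ℤ.+ v ℤ.* t) ∣α∣≡sαα ∣β∣≡sββ) ⟨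
    p ℤ.* (u ℤ.* + ℤ.∣ α ∣ ℤ.+ v ℤ.* + ℤ.∣ β ∣) ℤ.- + 1
      ≡⟨ cong (λ z → p ℤ.* z ℤ.- + 1) uα+vβ≡g₁ ⟩
    p ℤ.* + g₁ ℤ.- + 1
      ≡⟨ cong (λ z → p ℤ.* + g₁ ℤ.- z) (trans (cong +_ (sym gcd≡1)) (sym pg₁+wd≡g)) ⟩
    p ℤ.* + g₁ ℤ.- (p ℤ.* + g₁ ℤ.+ w ℤ.* + d)
      ≡⟨ cancel (p ℤ.* + g₁) w (+ d) ⟩
    ℤ.- w ℤ.* + d ∎)
  where
  open ≡-Reasoning
  g₁ = gcd ℤ.∣ α ∣ ℤ.∣ β ∣
  regroup : ∀ p u sα α v sβ β → p ℤ.* u ℤ.* sα ℤ.* α ℤ.+ p ℤ.* v ℤ.* sβ ℤ.* β ℤ.- + 1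
                              ≡ p ℤ.* (u ℤ.* (sα ℤ.* α) ℤ.+ v ℤ.* (sβ ℤ.* β)) ℤ.- + 1
  regroup = solveℤ-∀
  cancel : ∀ a w d → a ℤ.- (a ℤ.+ w ℤ.* d) ≡ ℤ.- w ℤ.* d
  cancel = solveℤ-∀

-- If g = gcd(|α|, |β|, d) ≥ 2, then k = d / g contradicts the hypothesis.
no-proper-multiple⇒gcd₃≡1 :
  ∀ m α β → (∀ k → 1 ℕ.≤ k → k ℕ.< suc m → + suc m ∣ + k ℤ.* α → + suc m ∣ + k ℤ.* β → ⊥) →
  gcd (gcd ℤ.∣ α ∣ ℤ.∣ β ∣) (suc m) ≡ 1
no-proper-multiple⇒gcd₃≡1 m α β no-multiple
  with gcd g₁ (suc m) | gcd[m,n]∣n g₁ (suc m)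
     | ℕ.∣-trans (gcd[m,n]∣m g₁ (suc m)) (gcd[m,n]∣m ℤ.∣ α ∣ ℤ.∣ β ∣)
     | ℕ.∣-trans (gcd[m,n]∣m g₁ (suc m)) (gcd[m,n]∣n ℤ.∣ α ∣ ℤ.∣ β ∣)
  where g₁ = gcd ℤ.∣ α ∣ ℤ.∣ β ∣
... | 0           | ℕ.divides q d≡q*0        | _   | _   = ⊥-elim (ℕ.1+n≢0 (trans d≡q*0 (ℕ.*-zeroʳ q)))
... | 1           | _                       | _   | _   = refl
... | suc (suc g) | ℕ.divides zero ()        | _   | _
... | suc (suc g) | ℕ.divides (suc q) d≡q*g  | g∣α | g∣β =
  ⊥-elim (no-multiple (suc q) (ℕ.s≤s ℕ.z≤n) q<d (multiple g∣α) (multiple g∣β))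
  where
  q<d : suc q ℕ.< suc m
  q<d = subst (suc q ℕ.<_) (sym d≡q*g) (ℕ.m<m*n (suc q) (suc (suc g)) (ℕ.s≤s (ℕ.s≤s ℕ.z≤n)))
  multiple : ∀ {γ} → suc (suc g) ℕ.∣ ℤ.∣ γ ∣ → + suc m ∣ + suc q ℤ.* γ
  multiple {γ} h = subst (_∣ + suc q ℤ.* γ) (trans (sym (ℤ.pos-* (suc q) (suc (suc g)))) (cong +_ (sym d≡q*g)))
                     (*-monoʳ-∣ (+ suc q) (∣ᵤ⇒∣ {+ suc (suc g)} {γ} h))

module ∑ℤ = Sum ℤ.+-*-semiring
module ∑ℚ = Sum (CommutativeRing.semiring ℚ.+-*-commutativeRing)

sumℤ≡∑ : ∀ {n} (f : Fin n → ℤ) → sumℤ f ≡ ∑ℤ.sum f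
sumℤ≡∑ {zero}  f = refl
sumℤ≡∑ {suc n} f = cong (ℤ._+_ (f fzero)) (sumℤ≡∑ (λ i → f (fsuc i)))

sumℚ≡∑ : ∀ {n} (f : Fin n → ℚ) → sumℚ f ≡ ∑ℚ.sum f
sumℚ≡∑ {zero}  f = refl
sumℚ≡∑ {suc n} f = cong (f fzero ℚ.+_) (sumℚ≡∑ (λ i → f (fsuc i)))

∑ℚ-linear : ∀ {n} c c′ (f f′ : Fin n → ℚ) →
            ∑ℚ.sum (λ k → c ℚ.* f k ℚ.+ c′ ℚ.* f′ k) ≡ c ℚ.* ∑ℚ.sum f ℚ.+ c′ ℚ.* ∑ℚ.sum f′
∑ℚ-linear c c′ f f′ = trans (∑ℚ.∑-distrib-+ (λ k → c ℚ.* f k) (λ k → c′ ℚ.* f′ k))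
  (sym (cong₂ ℚ._+_ (∑ℚ.*-distribˡ-sum c f) (∑ℚ.*-distribˡ-sum c′ f′)))

∑ℚ-neg : ∀ {n} (f : Fin n → ℚ) → ℚ.- ∑ℚ.sum f ≡ ∑ℚ.sum (λ k → ℚ.- f k)
∑ℚ-neg f = trans (neg≡-1* (∑ℚ.sum f))
  (trans (∑ℚ.*-distribˡ-sum (ℚ.- 1ℚ) f) (∑ℚ.sum-cong-≗ (λ k → sym (neg≡-1* (f k)))))
  where
  neg≡-1* : ∀ p → ℚ.- p ≡ ℚ.- 1ℚ ℚ.* p
  neg≡-1* = solve-∀ ℚ-ring

sumℚ-isInt : ∀ {n} (f : Fin n → ℚ) → (∀ i → IsInt (f i)) → IsInt (sumℚ f)
sumℚ-isInt {zero}  f _     = + 0 , refl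
sumℚ-isInt {suc n} f f-int = isInt-+ (f-int fzero) (sumℚ-isInt (λ i → f (fsuc i)) (λ i → f-int (fsuc i)))

δ : ∀ {n} → Fin n → Fin n → ℤ
δ fzero    fzero    = + 1
δ fzero    (fsuc _) = + 0
δ (fsuc _) fzero    = + 0
δ (fsuc k) (fsuc j) = δ k j

∑-δ : ∀ {n} (k : Fin n) (h : Fin n → ℤ) → ∑ℤ.sum (λ j → h j ℤ.* δ k j) ≡ h k
∑-δ {suc n} fzero h = begin
  h fzero ℤ.* + 1 ℤ.+ ∑ℤ.sum (λ j → h (fsuc j) ℤ.* + 0)  ≡⟨ cong₂ ℤ._+_ (ℤ.*-identityʳ (h fzero)) zeros ⟩
  h fzero ℤ.+ + 0                                       ≡⟨ ℤ.+-identityʳ (h fzero) ⟩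
  h fzero                                               ∎
  where
  open ≡-Reasoning
  zeros : ∑ℤ.sum (λ j → h (fsuc j) ℤ.* + 0) ≡ + 0
  zeros = trans (∑ℤ.sum-cong-≗ (λ j → ℤ.*-zeroʳ (h (fsuc j)))) (∑ℤ.sum-replicate-zero n)
∑-δ {suc n} (fsuc k) h = begin
  h fzero ℤ.* + 0 ℤ.+ ∑ℤ.sum (λ j → h (fsuc j) ℤ.* δ k j)  ≡⟨ cong₂ ℤ._+_ (ℤ.*-zeroʳ (h fzero)) (∑-δ k (λ j → h (fsuc j))) ⟩
  + 0 ℤ.+ h (fsuc k)                                      ≡⟨ ℤ.+-identityˡ (h (fsuc k)) ⟩
  h (fsuc k)                                              ∎
  where open ≡-Reasoning

∑-δ₂ : ∀ {n} (a b : Fin n) (h : Fin n → ℤ) → ∑ℤ.sum (λ j → h j ℤ.* (δ a j ℤ.+ δ b j)) ≡ h a ℤ.+ h b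
∑-δ₂ a b h = begin
  ∑ℤ.sum (λ j → h j ℤ.* (δ a j ℤ.+ δ b j))           ≡⟨ ∑ℤ.sum-cong-≗ (λ j → ℤ.*-distribˡ-+ (h j) (δ a j) (δ b j)) ⟩
  ∑ℤ.sum (λ j → h j ℤ.* δ a j ℤ.+ h j ℤ.* δ b j)     ≡⟨ ∑ℤ.∑-distrib-+ (λ j → h j ℤ.* δ a j) (λ j → h j ℤ.* δ b j) ⟩
  ∑ℤ.sum (λ j → h j ℤ.* δ a j) ℤ.+ ∑ℤ.sum (λ j → h j ℤ.* δ b j) ≡⟨ cong₂ ℤ._+_ (∑-δ a h) (∑-δ b h) ⟩
  h a ℤ.+ h b                                       ∎
  where open ≡-Reasoning

module Gram {n} (L : SymplecticLattice n) where
  open SymplecticLattice L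

  formℤ≡∑ : ∀ u v → formℤ gram u v ≡ ∑ℤ.sum (λ i → ∑ℤ.sum (λ j → u i ℤ.* gram i j ℤ.* v j))
  formℤ≡∑ u v = trans (sumℤ≡∑ (λ i → sumℤ (λ j → u i ℤ.* gram i j ℤ.* v j)))
                  (∑ℤ.sum-cong-≗ (λ i → sumℤ≡∑ (λ j → u i ℤ.* gram i j ℤ.* v j)))

  gram-diag : ∀ a → gram a a ≡ + 0
  gram-diag a = begin
    gram a a                                                        ≡⟨ ∑-δ a (λ i → gram i a) ⟨
    ∑ℤ.sum (λ i → gram i a ℤ.* δ a i)                               ≡⟨ ∑ℤ.sum-cong-≗ row ⟨
    ∑ℤ.sum (λ i → ∑ℤ.sum (λ j → δ a i ℤ.* gram i j ℤ.* δ a j))      ≡⟨ formℤ≡∑ (δ a) (δ a) ⟨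
    formℤ gram (δ a) (δ a)                                          ≡⟨ alternating (δ a) ⟩
    + 0                                                             ∎
    where
    open ≡-Reasoning
    row : ∀ i → ∑ℤ.sum (λ j → δ a i ℤ.* gram i j ℤ.* δ a j) ≡ gram i a ℤ.* δ a i
    row i = trans (∑-δ a (λ j → δ a i ℤ.* gram i j)) (ℤ.*-comm (δ a i) (gram i a))

  gram-antisym : ∀ a b → gram a b ≡ ℤ.- gram b a
  gram-antisym a b = begin
    gram a b                                                           ≡⟨ shuffle (gram a b) (gram b a) ⟩
    (+ 0 ℤ.+ gram a b) ℤ.+ (gram b a ℤ.+ + 0) ℤ.- gram b a             ≡⟨ cong₂ (λ p q → (p ℤ.+ gram a b) ℤ.+ (gram b a ℤ.+ q) ℤ.- gram b a)
                                                                             (gram-diag a) (gram-diag b) ⟨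
    (gram a a ℤ.+ gram a b) ℤ.+ (gram b a ℤ.+ gram b b) ℤ.- gram b a   ≡⟨ cong (ℤ._- gram b a) polarised ⟨
    formℤ gram u u ℤ.- gram b a                                        ≡⟨ cong (ℤ._- gram b a) (alternating u) ⟩
    + 0 ℤ.- gram b a                                                   ≡⟨ ℤ.+-identityˡ (ℤ.- gram b a) ⟩
    ℤ.- gram b a                                                       ∎
    where
    open ≡-Reasoning
    u : Fin n → ℤ
    u j = δ a j ℤ.+ δ b j
    shuffle : ∀ x y → x ≡ (+ 0 ℤ.+ x) ℤ.+ (y ℤ.+ + 0) ℤ.- y
    shuffle = solveℤ-∀
    row : ∀ i → ∑ℤ.sum (λ j → u i ℤ.* gram i j ℤ.* u j) ≡ (gram i a ℤ.+ gram i b) ℤ.* u i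
    row i = trans (∑-δ₂ a b (λ j → u i ℤ.* gram i j))
              (trans (sym (ℤ.*-distribˡ-+ (u i) (gram i a) (gram i b))) (ℤ.*-comm (u i) _))
    polarised : formℤ gram u u ≡ (gram a a ℤ.+ gram a b) ℤ.+ (gram b a ℤ.+ gram b b)
    polarised = trans (formℤ≡∑ u u)
                  (trans (∑ℤ.sum-cong-≗ row) (∑-δ₂ a b (λ i → gram i a ℤ.+ gram i b)))

-- The pairing, the dual lattice and D_Λ

module Pairing {n} (L : SymplecticLattice n) where
  open SymplecticLattice L
  open Gram L using (gram-antisym)

  ⟨_,_⟩ : Vecℚ n → Vecℚ n → ℚ
  ⟨_,_⟩ = ⟪_,_⟫ L

  private
    term : Vecℚ n → Vecℚ n → Fin n → Fin n → ℚ
    term v w i j = v i ℚ.* ι (gram i j) ℚ.* w j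

  ⟨⟩≡∑ : ∀ v w → ⟨ v , w ⟩ ≡ ∑ℚ.sum (λ i → ∑ℚ.sum (term v w i))
  ⟨⟩≡∑ v w = trans (sumℚ≡∑ (λ i → sumℚ (term v w i))) (∑ℚ.sum-cong-≗ (λ i → sumℚ≡∑ (term v w i)))

  ⟨⟩-cong : ∀ {v v′ w w′} → v ≗ v′ → w ≗ w′ → ⟨ v , w ⟩ ≡ ⟨ v′ , w′ ⟩
  ⟨⟩-cong {v} {v′} {w} {w′} v≗v′ w≗w′ = begin
    ⟨ v , w ⟩                                ≡⟨ ⟨⟩≡∑ v w ⟩
    ∑ℚ.sum (λ i → ∑ℚ.sum (term v w i))       ≡⟨ ∑ℚ.sum-cong-≗ (λ i → ∑ℚ.sum-cong-≗ (λ j →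
                                                   cong₂ (λ p q → p ℚ.* ι (gram i j) ℚ.* q) (v≗v′ i) (w≗w′ j))) ⟩
    ∑ℚ.sum (λ i → ∑ℚ.sum (term v′ w′ i))     ≡⟨ ⟨⟩≡∑ v′ w′ ⟨
    ⟨ v′ , w′ ⟩                              ∎
    where open ≡-Reasoning

  ⟨⟩-congʳ : ∀ u {w w′} → w ≗ w′ → ⟨ u , w ⟩ ≡ ⟨ u , w′ ⟩
  ⟨⟩-congʳ u = ⟨⟩-cong {u} (λ _ → refl)

  ⟨⟩-congˡ : ∀ u {v v′} → v ≗ v′ → ⟨ v , u ⟩ ≡ ⟨ v′ , u ⟩
  ⟨⟩-congˡ u v≗v′ = ⟨⟩-cong v≗v′ (λ _ → refl)

  ⟨⟩-lincombʳ : ∀ u i j a b → ⟨ u , lincomb i j a b ⟩ ≡ ι i ℚ.* ⟨ u , a ⟩ ℚ.+ ι j ℚ.* ⟨ u , b ⟩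
  ⟨⟩-lincombʳ u i j a b = begin
    ⟨ u , lincomb i j a b ⟩
      ≡⟨ ⟨⟩≡∑ u (lincomb i j a b) ⟩
    ∑ℚ.sum (λ k → ∑ℚ.sum (term u (lincomb i j a b) k))
      ≡⟨ ∑ℚ.sum-cong-≗ row ⟩
    ∑ℚ.sum (λ k → ι i ℚ.* ∑ℚ.sum (term u a k) ℚ.+ ι j ℚ.* ∑ℚ.sum (term u b k))
      ≡⟨ ∑ℚ-linear (ι i) (ι j) (λ k → ∑ℚ.sum (term u a k)) (λ k → ∑ℚ.sum (term u b k)) ⟩
    ι i ℚ.* ∑ℚ.sum (λ k → ∑ℚ.sum (term u a k)) ℚ.+ ι j ℚ.* ∑ℚ.sum (λ k → ∑ℚ.sum (term u b k))
      ≡⟨ cong₂ (λ p q → ι i ℚ.* p ℚ.+ ι j ℚ.* q) (⟨⟩≡∑ u a) (⟨⟩≡∑ u b) ⟨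
    ι i ℚ.* ⟨ u , a ⟩ ℚ.+ ι j ℚ.* ⟨ u , b ⟩
      ∎
    where
    open ≡-Reasoning
    distrib : ∀ x g c c′ y y′ → x ℚ.* g ℚ.* (c ℚ.* y ℚ.+ c′ ℚ.* y′) ≡ c ℚ.* (x ℚ.* g ℚ.* y) ℚ.+ c′ ℚ.* (x ℚ.* g ℚ.* y′)
    distrib = solve-∀ ℚ-ring
    row : ∀ k → ∑ℚ.sum (term u (lincomb i j a b) k) ≡ ι i ℚ.* ∑ℚ.sum (term u a k) ℚ.+ ι j ℚ.* ∑ℚ.sum (term u b k)
    row k = trans (∑ℚ.sum-cong-≗ (λ l → distrib (u k) (ι (gram k l)) (ι i) (ι j) (a l) (b l)))
                  (∑ℚ-linear (ι i) (ι j) (term u a k) (term u b k))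

  ⟨⟩-antisym : ∀ v w → ⟨ v , w ⟩ ≡ ℚ.- ⟨ w , v ⟩
  ⟨⟩-antisym v w = begin
    ⟨ v , w ⟩                                                   ≡⟨ ⟨⟩≡∑ v w ⟩
    ∑ℚ.sum (λ i → ∑ℚ.sum (term v w i))                          ≡⟨ ∑ℚ.sum-cong-≗ (λ i → ∑ℚ.sum-cong-≗ (λ j → swap i j)) ⟩
    ∑ℚ.sum (λ i → ∑ℚ.sum (λ j → ℚ.- term w v j i))              ≡⟨ ∑ℚ.sum-cong-≗ (λ i → ∑ℚ-neg (λ j → term w v j i)) ⟨
    ∑ℚ.sum (λ i → ℚ.- ∑ℚ.sum (λ j → term w v j i))              ≡⟨ ∑ℚ-neg (λ i → ∑ℚ.sum (λ j → term w v j i)) ⟨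
    ℚ.- ∑ℚ.sum (λ i → ∑ℚ.sum (λ j → term w v j i))              ≡⟨ cong ℚ.-_ (∑ℚ.∑-comm (λ i j → term w v j i)) ⟩
    ℚ.- ∑ℚ.sum (λ j → ∑ℚ.sum (term w v j))                      ≡⟨ cong ℚ.-_ (⟨⟩≡∑ w v) ⟨
    ℚ.- ⟨ w , v ⟩                                               ∎
    where
    open ≡-Reasoning
    flip : ∀ x g y → x ℚ.* (ℚ.- g) ℚ.* y ≡ ℚ.- (y ℚ.* g ℚ.* x)
    flip = solve-∀ ℚ-ring
    swap : ∀ i j → term v w i j ≡ ℚ.- term w v j i
    swap i j = trans (cong (λ g → v i ℚ.* g ℚ.* w j) (trans (cong ι (gram-antisym i j)) (ι-neg (gram j i))))
                     (flip (v i) (ι (gram j i)) (w j))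

  ⟨⟩-self : ∀ v → ⟨ v , v ⟩ ≡ 0ℚ
  ⟨⟩-self v = begin
    p                     ≡⟨ ℚ.*-identityˡ p ⟨
    (ℚ.½ ℚ.+ ℚ.½) ℚ.* p   ≡⟨ halve ℚ.½ p ⟩
    ℚ.½ ℚ.* (p ℚ.+ p)     ≡⟨ cong (λ q → ℚ.½ ℚ.* (p ℚ.+ q)) (⟨⟩-antisym v v) ⟩
    ℚ.½ ℚ.* (p - p)       ≡⟨ cong (ℚ.½ ℚ.*_) (ℚ.+-inverseʳ p) ⟩
    ℚ.½ ℚ.* 0ℚ            ≡⟨ ℚ.*-zeroʳ ℚ.½ ⟩
    0ℚ                    ∎
    where
    open ≡-Reasoning
    p = ⟨ v , v ⟩
    halve : ∀ h p → (h ℚ.+ h) ℚ.* p ≡ h ℚ.* (p ℚ.+ p)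
    halve = solve-∀ ℚ-ring

  ⟨⟩-lincombˡ : ∀ u i j a b → ⟨ lincomb i j a b , u ⟩ ≡ ι i ℚ.* ⟨ a , u ⟩ ℚ.+ ι j ℚ.* ⟨ b , u ⟩
  ⟨⟩-lincombˡ u i j a b = begin
    ⟨ lincomb i j a b , u ⟩                           ≡⟨ ⟨⟩-antisym (lincomb i j a b) u ⟩
    ℚ.- ⟨ u , lincomb i j a b ⟩                       ≡⟨ cong ℚ.-_ (⟨⟩-lincombʳ u i j a b) ⟩
    ℚ.- (ι i ℚ.* ⟨ u , a ⟩ ℚ.+ ι j ℚ.* ⟨ u , b ⟩)     ≡⟨ negate (ι i) (ι j) ⟨ u , a ⟩ ⟨ u , b ⟩ ⟩
    ι i ℚ.* (ℚ.- ⟨ u , a ⟩) ℚ.+ ι j ℚ.* (ℚ.- ⟨ u , b ⟩)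
      ≡⟨ cong₂ (λ p q → ι i ℚ.* p ℚ.+ ι j ℚ.* q) (⟨⟩-antisym a u) (⟨⟩-antisym b u) ⟨
    ι i ℚ.* ⟨ a , u ⟩ ℚ.+ ι j ℚ.* ⟨ b , u ⟩           ∎
    where
    open ≡-Reasoning
    negate : ∀ c c′ p q → ℚ.- (c ℚ.* p ℚ.+ c′ ℚ.* q) ≡ c ℚ.* (ℚ.- p) ℚ.+ c′ ℚ.* (ℚ.- q)
    negate = solve-∀ ℚ-ring

  private
    unpad : ∀ c p → c ℚ.* p ℚ.+ 0ℚ ℚ.* p ≡ c ℚ.* p
    unpad = solve-∀ ℚ-ring

  ⟨⟩-·ʳ : ∀ u k v → ⟨ u , k ·ᵥ v ⟩ ≡ ι k ℚ.* ⟨ u , v ⟩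
  ⟨⟩-·ʳ u k v = trans (⟨⟩-congʳ u (·ᵥ-as-lincombˡ k v v))
                  (trans (⟨⟩-lincombʳ u k (+ 0) v v) (unpad (ι k) ⟨ u , v ⟩))

  ⟨⟩-·ˡ : ∀ u k v → ⟨ k ·ᵥ v , u ⟩ ≡ ι k ℚ.* ⟨ v , u ⟩
  ⟨⟩-·ˡ u k v = trans (⟨⟩-congˡ u (·ᵥ-as-lincombˡ k v v))
                  (trans (⟨⟩-lincombˡ u k (+ 0) v v) (unpad (ι k) ⟨ v , u ⟩))

  ⟨⟩-0ʳ : ∀ u → ⟨ u , 0ᵥ ⟩ ≡ 0ℚ
  ⟨⟩-0ʳ u = trans (⟨⟩-congʳ u {0ᵥ} {(+ 0) ·ᵥ u} (λ t → sym (ℚ.*-zeroˡ (u t))))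
              (trans (⟨⟩-·ʳ u (+ 0) u) (ℚ.*-zeroˡ ⟨ u , u ⟩))

module Discriminant {n} (L : SymplecticLattice n) where
  open SymplecticLattice L using (gram)
  open Pairing L public

  ≈⇒≋ : ∀ {v w} → _≈_ L v w → v ≋ w
  ≈⇒≋ v≈w t = mod1 (v≈w t)

  ≋⇒≈ : ∀ {v w} → v ≋ w → _≈_ L v w
  ≋⇒≈ v≋w t = integral (v≋w t)

  ⟨⟩-congʳ-≋ : ∀ u {v w} → InDual L u → v ≋ w → ⟨ u , v ⟩ ≈ᶻ ⟨ u , w ⟩
  ⟨⟩-congʳ-≋ u {v} {w} u-dual v≋w = mod1 (subst IsInt (sym difference) (u-dual c))
    where
    c : Fin n → ℤ
    c t = proj₁ (integral (v≋w t))
    split : ∀ p q → p ≡ 1ℚ ℚ.* q ℚ.+ 1ℚ ℚ.* (p - q)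
    split = solve-∀ ℚ-ring
    v≗ : v ≗ lincomb (+ 1) (+ 1) w (embed c)
    v≗ t = trans (split (v t) (w t)) (cong (λ z → 1ℚ ℚ.* w t ℚ.+ 1ℚ ℚ.* z) (proj₂ (integral (v≋w t))))
    cancel : ∀ p q → 1ℚ ℚ.* p ℚ.+ 1ℚ ℚ.* q - p ≡ q
    cancel = solve-∀ ℚ-ring
    difference : ⟨ u , v ⟩ - ⟨ u , w ⟩ ≡ ⟨ u , embed c ⟩
    difference = trans (cong (_- ⟨ u , w ⟩) (trans (⟨⟩-congʳ u v≗) (⟨⟩-lincombʳ u (+ 1) (+ 1) w (embed c))))
                       (cancel ⟨ u , w ⟩ ⟨ u , embed c ⟩)

  ⟨⟩-congˡ-≋ : ∀ u {v w} → InDual L u → v ≋ w → ⟨ v , u ⟩ ≈ᶻ ⟨ w , u ⟩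
  ⟨⟩-congˡ-≋ u {v} {w} u-dual v≋w = begin
    ⟨ v , u ⟩         ≡⟨ ⟨⟩-antisym v u ⟩
    ℚ.- ⟨ u , v ⟩     ≈⟨ -‿congᶻ (⟨⟩-congʳ-≋ u u-dual v≋w) ⟩
    ℚ.- ⟨ u , w ⟩     ≡⟨ ⟨⟩-antisym w u ⟨
    ⟨ w , u ⟩         ∎
    where open ≈ᶻ-Reasoning

  dual-embed : ∀ a → InDual L (embed a)
  dual-embed a b = sumℚ-isInt _ (λ i → sumℚ-isInt _ (λ j →
    a i ℤ.* gram i j ℤ.* b j ,
    sym (trans (ι-* (a i ℤ.* gram i j) (b j)) (cong (ℚ._* ι (b j)) (ι-* (a i) (gram i j))))))

  dual-lincomb : ∀ i j {a b} → InDual L a → InDual L b → InDual L (lincomb i j a b)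
  dual-lincomb i j {a} {b} a-dual b-dual e =
    subst IsInt (sym (⟨⟩-lincombˡ (embed e) i j a b))
      (isInt-+ (isInt-ι* i (a-dual e)) (isInt-ι* j (b-dual e)))

  dual-resp : ∀ {v w} → v ≋ w → InDual L v → InDual L w
  dual-resp {v} {w} v≋w v-dual e = ≈ᶻ0⇒isInt (begin
    ⟨ w , embed e ⟩   ≈⟨ ⟨⟩-congˡ-≋ (embed e) (dual-embed e) v≋w ⟨
    ⟨ v , embed e ⟩   ≈⟨ isInt⇒≈ᶻ0 (v-dual e) ⟩
    0ℚ                ∎)
    where open ≈ᶻ-Reasoning

  ⟨⟩-torsion : ∀ m u v → InDual L u → ((+ suc m) ·ᵥ v) ≋ 0ᵥ →
               ∃[ α ] ⟨ u , v ⟩ ≡ ι α ℚ.* recip (suc m)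
  ⟨⟩-torsion m u v u-dual dv≋0 =
    let (α , eq) = ≈ᶻ0⇒isInt d⟨u,v⟩≈ᶻ0 in α , ι*≡⇒≡*recip m ⟨ u , v ⟩ eq
    where
    open ≈ᶻ-Reasoning
    d⟨u,v⟩≈ᶻ0 : ι (+ suc m) ℚ.* ⟨ u , v ⟩ ≈ᶻ 0ℚ
    d⟨u,v⟩≈ᶻ0 = begin
      ι (+ suc m) ℚ.* ⟨ u , v ⟩   ≡⟨ ⟨⟩-·ʳ u (+ suc m) v ⟨
      ⟨ u , (+ suc m) ·ᵥ v ⟩      ≈⟨ ⟨⟩-congʳ-≋ u u-dual dv≋0 ⟩
      ⟨ u , 0ᵥ ⟩                  ≡⟨ ⟨⟩-0ʳ u ⟩
      0ℚ                          ∎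

  ⟨⟩-lincomb-≈ᶻ0 : ∀ u i j a b → ⟨ u , a ⟩ ≈ᶻ 0ℚ → ⟨ u , b ⟩ ≈ᶻ 0ℚ → ⟨ u , lincomb i j a b ⟩ ≈ᶻ 0ℚ
  ⟨⟩-lincomb-≈ᶻ0 u i j a b ua≈ᶻ0 ub≈ᶻ0 = begin
    ⟨ u , lincomb i j a b ⟩                 ≡⟨ ⟨⟩-lincombʳ u i j a b ⟩
    ι i ℚ.* ⟨ u , a ⟩ ℚ.+ ι j ℚ.* ⟨ u , b ⟩ ≈⟨ +-congᶻ (ι*-congᶻ i ua≈ᶻ0) (ι*-congᶻ j ub≈ᶻ0) ⟩
    ι i ℚ.* 0ℚ ℚ.+ ι j ℚ.* 0ℚ               ≡⟨ annihilate (ι i) (ι j) ⟩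
    0ℚ                                      ∎
    where
    open ≈ᶻ-Reasoning
    annihilate : ∀ c e → c ℚ.* 0ℚ ℚ.+ e ℚ.* 0ℚ ≡ 0ℚ
    annihilate = solve-∀ ℚ-ring

  ℕ-multiple-∈ : (D₁ : Subgroup L) → ∀ k {v} → Subgroup.Mem D₁ v → Subgroup.Mem D₁ ((+ k) ·ᵥ v)
  ℕ-multiple-∈ D₁ zero {v} _ = resp 0ᵥ ((+ 0) ·ᵥ v) (≋⇒≈ (≗⇒≋ (λ t → sym (ℚ.*-zeroˡ (v t))))) has0
    where open Subgroup D₁
  ℕ-multiple-∈ D₁ (suc k) {v} v∈D₁ =
    resp (v +ᵥ ((+ k) ·ᵥ v)) ((+ suc k) ·ᵥ v) (≋⇒≈ (≗⇒≋ step)) (closed+ v ((+ k) ·ᵥ v) v∈D₁ (ℕ-multiple-∈ D₁ k v∈D₁))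
    where
    open Subgroup D₁
    collect : ∀ c p → p ℚ.+ c ℚ.* p ≡ (1ℚ ℚ.+ c) ℚ.* p
    collect = solve-∀ ℚ-ring
    step : v +ᵥ ((+ k) ·ᵥ v) ≗ (+ suc k) ·ᵥ v
    step t = trans (collect (ι (+ k)) (v t)) (cong (ℚ._* v t) (sym (ι-+ (+ 1) (+ k))))

  module Span {x y} (x-dual : InDual L x) (y-dual : InDual L y) where

    lincomb-∈ : ∀ i j {v} → v ≋ lincomb i j x y → Gen L x y v
    lincomb-∈ i j v≋ = dual-resp (≋-sym v≋) (dual-lincomb i j {x} {y} x-dual y-dual) , i , j , ≋⇒≈ v≋

    x∈span : Gen L x y x
    x∈span = lincomb-∈ (+ 1) (+ 0) (≗⇒≋ (λ t → trans (sym (ℚ.*-identityˡ (x t))) (·ᵥ-as-lincombˡ (+ 1) x y t)))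

    y∈span : Gen L x y y
    y∈span = lincomb-∈ (+ 0) (+ 1) (≗⇒≋ (λ t → trans (sym (ℚ.*-identityˡ (y t))) (·ᵥ-as-lincombʳ (+ 1) x y t)))

    span : Subgroup L
    span = record
      { Mem     = Gen L x y
      ; ⊆dual   = λ _ → proj₁
      ; resp    = λ { v w v≈w (_ , i , j , v≈) → lincomb-∈ i j (≋-trans (≋-sym (≈⇒≋ {v} {w} v≈w)) (≈⇒≋ {v} v≈)) }
      ; has0    = lincomb-∈ (+ 0) (+ 0) (≗⇒≋ (λ t → sym (lincomb-zero x y t)))
      ; closed+ = λ { v w (_ , i , j , v≈) (_ , i′ , j′ , w≈) → lincomb-∈ (i ℤ.+ i′) (j ℤ.+ j′)
                        (≋-trans (+ᵥ-cong (≈⇒≋ {v} v≈) (≈⇒≋ {w} w≈)) (≗⇒≋ (lincomb-+ i j i′ j′ x y))) }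
      ; closed- = λ { v (_ , i , j , v≈) → lincomb-∈ (ℤ.- i) (ℤ.- j)
                        (≋-trans (-ᵥ-cong (≈⇒≋ {v} v≈)) (≗⇒≋ (lincomb-neg i j x y))) }
      }

    span-perp : ∀ u → InDual L u → ⟨ u , x ⟩ ≈ᶻ 0ℚ → ⟨ u , y ⟩ ≈ᶻ 0ℚ → Perp L (Gen L x y) u
    span-perp u u-dual ux≈ᶻ0 uy≈ᶻ0 = u-dual , λ { z (_ , i , j , z≈) →
      ≈ᶻ0⇒isInt (≈ᶻ-trans (⟨⟩-congʳ-≋ u u-dual (≈⇒≋ {z} z≈)) (⟨⟩-lincomb-≈ᶻ0 u i j x y ux≈ᶻ0 uy≈ᶻ0)) }

-- Hyperbolic pairs and the four conditions

module HyperbolicPair {n} (L : SymplecticLattice n) (m : ℕ) {x y : Vecℚ n}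
  (x-dual : InDual L x) (y-dual : InDual L y)
  (dx≋0 : ((+ suc m) ·ᵥ x) ≋ 0ᵥ) (dy≋0 : ((+ suc m) ·ᵥ y) ≋ 0ᵥ)
  (⟨x,y⟩≈ᶻ1/d : ⟪_,_⟫ L x y ≈ᶻ recip (suc m)) where

  open Discriminant L
  open Span {x} {y} x-dual y-dual

  private
    d : ℤ
    d = + suc m
    r : ℚ
    r = recip (suc m)

  ⟨x,lincomb⟩≈ᶻ : ∀ i j → ⟨ x , lincomb i j x y ⟩ ≈ᶻ ι j ℚ.* r
  ⟨x,lincomb⟩≈ᶻ i j = begin
    ⟨ x , lincomb i j x y ⟩                 ≡⟨ ⟨⟩-lincombʳ x i j x y ⟩
    ι i ℚ.* ⟨ x , x ⟩ ℚ.+ ι j ℚ.* ⟨ x , y ⟩ ≡⟨ cong (λ p → ι i ℚ.* p ℚ.+ ι j ℚ.* ⟨ x , y ⟩) (⟨⟩-self x) ⟩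
    ι i ℚ.* 0ℚ ℚ.+ ι j ℚ.* ⟨ x , y ⟩        ≈⟨ +-congˡᶻ (ι i ℚ.* 0ℚ) (ι*-congᶻ j ⟨x,y⟩≈ᶻ1/d) ⟩
    ι i ℚ.* 0ℚ ℚ.+ ι j ℚ.* r                ≡⟨ drop (ι i) (ι j ℚ.* r) ⟩
    ι j ℚ.* r                               ∎
    where
    open ≈ᶻ-Reasoning
    drop : ∀ c p → c ℚ.* 0ℚ ℚ.+ p ≡ p
    drop = solve-∀ ℚ-ring

  ⟨lincomb,y⟩≈ᶻ : ∀ i j → ⟨ lincomb i j x y , y ⟩ ≈ᶻ ι i ℚ.* r
  ⟨lincomb,y⟩≈ᶻ i j = begin
    ⟨ lincomb i j x y , y ⟩                 ≡⟨ ⟨⟩-lincombˡ y i j x y ⟩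
    ι i ℚ.* ⟨ x , y ⟩ ℚ.+ ι j ℚ.* ⟨ y , y ⟩ ≡⟨ cong (λ p → ι i ℚ.* ⟨ x , y ⟩ ℚ.+ ι j ℚ.* p) (⟨⟩-self y) ⟩
    ι i ℚ.* ⟨ x , y ⟩ ℚ.+ ι j ℚ.* 0ℚ        ≈⟨ +-congʳᶻ (ι j ℚ.* 0ℚ) (ι*-congᶻ i ⟨x,y⟩≈ᶻ1/d) ⟩
    ι i ℚ.* r ℚ.+ ι j ℚ.* 0ℚ                ≡⟨ drop (ι j) (ι i ℚ.* r) ⟩
    ι i ℚ.* r                               ∎
    where
    open ≈ᶻ-Reasoning
    drop : ∀ c p → p ℚ.+ c ℚ.* 0ℚ ≡ p
    drop = solve-∀ ℚ-ring

  ∣⇒lincomb≋0 : ∀ {i j} → d ∣ i → d ∣ j → lincomb i j x y ≋ 0ᵥ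
  ∣⇒lincomb≋0 d∣i d∣j t = +-congᶻ (·ᵥ-∣-torsion d∣i dx≋0 t) (·ᵥ-∣-torsion d∣j dy≋0 t)

  lincomb-≋⇒∣ : ∀ i j i′ j′ → lincomb i j x y ≋ lincomb i′ j′ x y → d ∣ i ℤ.- i′ × d ∣ j ℤ.- j′
  lincomb-≋⇒∣ i j i′ j′ lc≋lc′ = *recip≈ᶻ⇒∣ m {i} {i′} i/d≈ᶻi′/d , *recip≈ᶻ⇒∣ m {j} {j′} j/d≈ᶻj′/d
    where
    open ≈ᶻ-Reasoning
    i/d≈ᶻi′/d : ι i ℚ.* r ≈ᶻ ι i′ ℚ.* r
    i/d≈ᶻi′/d = begin
      ι i ℚ.* r                 ≈⟨ ⟨lincomb,y⟩≈ᶻ i j ⟨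
      ⟨ lincomb i j x y , y ⟩   ≈⟨ ⟨⟩-congˡ-≋ y y-dual lc≋lc′ ⟩
      ⟨ lincomb i′ j′ x y , y ⟩ ≈⟨ ⟨lincomb,y⟩≈ᶻ i′ j′ ⟩
      ι i′ ℚ.* r                ∎
    j/d≈ᶻj′/d : ι j ℚ.* r ≈ᶻ ι j′ ℚ.* r
    j/d≈ᶻj′/d = begin
      ι j ℚ.* r                 ≈⟨ ⟨x,lincomb⟩≈ᶻ i j ⟨
      ⟨ x , lincomb i j x y ⟩   ≈⟨ ⟨⟩-congʳ-≋ x x-dual lc≋lc′ ⟩
      ⟨ x , lincomb i′ j′ x y ⟩ ≈⟨ ⟨x,lincomb⟩≈ᶻ i′ j′ ⟩
      ι j′ ℚ.* r                ∎

  ∣⇒lincomb-≋ : ∀ i j i′ j′ → d ∣ i ℤ.- i′ → d ∣ j ℤ.- j′ → lincomb i j x y ≋ lincomb i′ j′ x y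
  ∣⇒lincomb-≋ i j i′ j′ d∣i-i′ d∣j-j′ = begin
    lincomb i j x y                                                     ≡⟨ cong₂ (λ a b → lincomb a b x y) (restore i i′) (restore j j′) ⟩
    lincomb (i ℤ.- i′ ℤ.+ i′) (j ℤ.- j′ ℤ.+ j′) x y                     ≈⟨ ≗⇒≋ (lincomb-+ (i ℤ.- i′) (j ℤ.- j′) i′ j′ x y) ⟨
    lincomb (i ℤ.- i′) (j ℤ.- j′) x y +ᵥ lincomb i′ j′ x y              ≈⟨ +ᵥ-cong (∣⇒lincomb≋0 d∣i-i′ d∣j-j′) ≋-refl ⟩
    0ᵥ +ᵥ lincomb i′ j′ x y                                             ≈⟨ ≗⇒≋ (λ t → ℚ.+-identityˡ (lincomb i′ j′ x y t)) ⟩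
    lincomb i′ j′ x y                                                   ∎
    where
    open SetoidReasoning (≋-setoid n)
    restore : ∀ a b → a ≡ a ℤ.- b ℤ.+ b
    restore = solveℤ-∀

  span-iso : IsoZmod² L (suc m) span
  span-iso = (λ i j → lincomb i j x y)
           , (λ i j → lincomb-∈ i j ≋-refl)
           , (λ i j i′ j′ → ≋⇒≈ (≋-sym (≗⇒≋ (lincomb-+ i j i′ j′ x y))))
           , (λ i j i′ j′ d∣i-i′ d∣j-j′ → ≋⇒≈ (∣⇒lincomb-≋ i j i′ j′ (∣ᵤ⇒∣ d∣i-i′) (∣ᵤ⇒∣ d∣j-j′)))
           , (λ i j i′ j′ lc≈lc′ → let (d∣i-i′ , d∣j-j′) = lincomb-≋⇒∣ i j i′ j′ (≈⇒≋ lc≈lc′)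
                                    in ∣⇒∣ᵤ d∣i-i′ , ∣⇒∣ᵤ d∣j-j′)
           , (λ { v (_ , i , j , v≈) → i , j , v≈ })

  span-∩-perp : ∀ v → Gen L x y v → Perp L (Gen L x y) v → _≈_ L v 0ᵥ
  span-∩-perp v (_ , i , j , v≈lc) (_ , v⊥span) = ≋⇒≈ (≋-trans v≋lc (∣⇒lincomb≋0 d∣i d∣j))
    where
    open ≈ᶻ-Reasoning
    v≋lc : v ≋ lincomb i j x y
    v≋lc = ≈⇒≋ {v} v≈lc
    d∣i : d ∣ i
    d∣i = *recip≈ᶻ0⇒∣ m i (begin
      ι i ℚ.* r                 ≈⟨ ⟨lincomb,y⟩≈ᶻ i j ⟨
      ⟨ lincomb i j x y , y ⟩   ≈⟨ ⟨⟩-congˡ-≋ y y-dual v≋lc ⟨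
      ⟨ v , y ⟩                 ≈⟨ isInt⇒≈ᶻ0 (v⊥span y y∈span) ⟩
      0ℚ                        ∎)
    d∣j : d ∣ j
    d∣j = *recip≈ᶻ0⇒∣ m j (begin
      ι j ℚ.* r                 ≈⟨ ⟨x,lincomb⟩≈ᶻ i j ⟨
      ⟨ x , lincomb i j x y ⟩   ≈⟨ ⟨⟩-congʳ-≋ x x-dual v≋lc ⟨
      ⟨ x , v ⟩                 ≡⟨ ⟨⟩-antisym x v ⟩
      ℚ.- ⟨ v , x ⟩             ≈⟨ -‿congᶻ (isInt⇒≈ᶻ0 (v⊥span x x∈span)) ⟩
      0ℚ                        ∎)

  span-component : ℤ → ℤ → Vecℚ n
  span-component σ τ = lincomb τ (ℤ.- σ) x y

  ⟨component,x⟩≈ᶻ : ∀ σ τ → ⟨ span-component σ τ , x ⟩ ≈ᶻ ι σ ℚ.* r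
  ⟨component,x⟩≈ᶻ σ τ = begin
    ⟨ span-component σ τ , x ⟩       ≡⟨ ⟨⟩-antisym (span-component σ τ) x ⟩
    ℚ.- ⟨ x , span-component σ τ ⟩   ≈⟨ -‿congᶻ (⟨x,lincomb⟩≈ᶻ τ (ℤ.- σ)) ⟩
    ℚ.- (ι (ℤ.- σ) ℚ.* r)            ≡⟨ cong (λ s → ℚ.- (s ℚ.* r)) (ι-neg σ) ⟩
    ℚ.- ((ℚ.- ι σ) ℚ.* r)            ≡⟨ cancel (ι σ) r ⟩
    ι σ ℚ.* r                        ∎
    where
    open ≈ᶻ-Reasoning
    cancel : ∀ s r → ℚ.- ((ℚ.- s) ℚ.* r) ≡ s ℚ.* r
    cancel = solve-∀ ℚ-ring

  span-decomposition : ∀ v → InDual L v →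
                       ∃[ a ] ∃[ b ] (Gen L x y a × Perp L (Gen L x y) b × _≈_ L v (a +ᵥ b))
  span-decomposition v v-dual = from-pairings (⟨⟩-torsion m v x v-dual dx≋0) (⟨⟩-torsion m v y v-dual dy≋0)
    where
    from-pairings : ∃[ σ ] ⟨ v , x ⟩ ≡ ι σ ℚ.* r → ∃[ τ ] ⟨ v , y ⟩ ≡ ι τ ℚ.* r →
                    ∃[ a ] ∃[ b ] (Gen L x y a × Perp L (Gen L x y) b × _≈_ L v (a +ᵥ b))
    from-pairings (σ , ⟨v,x⟩≡σ/d) (τ , ⟨v,y⟩≡τ/d) =
      a , b , lincomb-∈ τ (ℤ.- σ) ≋-refl ,
      span-perp b b-dual (b⊥ x (ι σ ℚ.* r) ⟨v,x⟩≡σ/d (⟨component,x⟩≈ᶻ σ τ))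
                         (b⊥ y (ι τ ℚ.* r) ⟨v,y⟩≡τ/d (⟨lincomb,y⟩≈ᶻ τ (ℤ.- σ))) ,
      ≋⇒≈ (≗⇒≋ (λ t → split (v t) (a t)))
      where
      a b : Vecℚ n
      a = span-component σ τ
      b = lincomb (+ 1) (ℤ.- + 1) v a
      b-dual : InDual L b
      b-dual = dual-lincomb (+ 1) (ℤ.- + 1) {v} {a} v-dual (dual-lincomb τ (ℤ.- σ) {x} {y} x-dual y-dual)
      difference : ∀ p q → 1ℚ ℚ.* p ℚ.+ (ℚ.- 1ℚ) ℚ.* q ≡ p - q
      difference = solve-∀ ℚ-ring
      b⊥ : ∀ u c → ⟨ v , u ⟩ ≡ c → ⟨ a , u ⟩ ≈ᶻ c → ⟨ b , u ⟩ ≈ᶻ 0ℚ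
      b⊥ u c ⟨v,u⟩≡c ⟨a,u⟩≈ᶻc = begin
        ⟨ b , u ⟩                ≡⟨ trans (⟨⟩-lincombˡ u (+ 1) (ℤ.- + 1) v a) (difference ⟨ v , u ⟩ ⟨ a , u ⟩) ⟩
        ⟨ v , u ⟩ - ⟨ a , u ⟩    ≈⟨ +-congᶻ (≈ᶻ-reflexive ⟨v,u⟩≡c) (-‿congᶻ ⟨a,u⟩≈ᶻc) ⟩
        c - c                    ≡⟨ ℚ.+-inverseʳ c ⟩
        0ℚ                       ∎
        where open ≈ᶻ-Reasoning
      split : ∀ p q → p ≡ q ℚ.+ (1ℚ ℚ.* p ℚ.+ (ℚ.- 1ℚ) ℚ.* q)
      split = solve-∀ ℚ-ring

  span-directSum : DirectSumWithPerp L (Gen L x y)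
  span-directSum = span-decomposition , span-∩-perp

module Partner {n} (L : SymplecticLattice n) (m : ℕ) {x : Vecℚ n}
  (x-dual : InDual L x) (x-order : HasOrder L x (suc m)) where

  open Discriminant L

  private
    d : ℤ
    d = + suc m
    r : ℚ
    r = recip (suc m)

  dx≋0 : (d ·ᵥ x) ≋ 0ᵥ
  dx≋0 = ≈⇒≋ {d ·ᵥ x} (proj₁ (proj₂ x-order))

  C1 C2 : Set₁
  C1 = ∃[ D₁ ] (Subgroup.Mem D₁ x × IsoZmod² L (suc m) D₁ × DirectSumWithPerp L (Subgroup.Mem D₁))
  C2 = ∃[ D₁ ] (Subgroup.Mem D₁ x × IsoZmod² L (suc m) D₁ × NondegOn L (Subgroup.Mem D₁))

  C3 C4 : Set
  C3 = ∃[ y ] (InDual L y × DirectSumWithPerp L (Gen L x y))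
  C4 = ∃[ y ] (InDual L y × HasOrder L y (suc m) × IsInt (⟪_,_⟫ L x y - recip (suc m)))

  partner-order : ∀ y → (d ·ᵥ y) ≋ 0ᵥ → ⟨ x , y ⟩ ≈ᶻ r → HasOrder L y (suc m)
  partner-order y dy≋0 ⟨x,y⟩≈ᶻr = ℕ.s≤s ℕ.z≤n , ≋⇒≈ dy≋0 , no-smaller
    where
    no-smaller : ∀ k → 1 ℕ.≤ k → k ℕ.< suc m → ¬ _≈_ L ((+ k) ·ᵥ y) 0ᵥ
    no-smaller k 1≤k k<d ky≈0 = ℕ.<⇒≱ k<d (ℕ.∣⇒≤ {{ℕ.>-nonZero 1≤k}} (∣⇒∣ᵤ (*recip≈ᶻ0⇒∣ m (+ k) k/d≈ᶻ0)))
      where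
      open ≈ᶻ-Reasoning
      k/d≈ᶻ0 : ι (+ k) ℚ.* r ≈ᶻ 0ℚ
      k/d≈ᶻ0 = begin
        ι (+ k) ℚ.* r               ≈⟨ ι*-congᶻ (+ k) ⟨x,y⟩≈ᶻr ⟨
        ι (+ k) ℚ.* ⟨ x , y ⟩       ≡⟨ ⟨⟩-·ʳ x (+ k) y ⟨
        ⟨ x , (+ k) ·ᵥ y ⟩          ≈⟨ ⟨⟩-congʳ-≋ x x-dual (≈⇒≋ {(+ k) ·ᵥ y} ky≈0) ⟩
        ⟨ x , 0ᵥ ⟩                  ≡⟨ ⟨⟩-0ʳ x ⟩
        0ℚ                          ∎

  multiple-⊥ : ∀ k γ w → ⟨ x , w ⟩ ≡ ι γ ℚ.* r → d ∣ + k ℤ.* γ → ⟨ (+ k) ·ᵥ x , w ⟩ ≈ᶻ 0ℚ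
  multiple-⊥ k γ w ⟨x,w⟩≡γ/d d∣kγ = begin
    ⟨ (+ k) ·ᵥ x , w ⟩            ≡⟨ ⟨⟩-·ˡ w (+ k) x ⟩
    ι (+ k) ℚ.* ⟨ x , w ⟩         ≡⟨ cong (ι (+ k) ℚ.*_) ⟨x,w⟩≡γ/d ⟩
    ι (+ k) ℚ.* (ι γ ℚ.* r)       ≡⟨ ℚ.*-assoc (ι (+ k)) (ι γ) r ⟨
    ι (+ k) ℚ.* ι γ ℚ.* r         ≡⟨ cong (ℚ._* r) (ι-* (+ k) γ) ⟨
    ι (+ k ℤ.* γ) ℚ.* r           ≈⟨ ∣⇒*recip≈ᶻ0 m (+ k ℤ.* γ) d∣kγ ⟩
    0ℚ                            ∎
    where open ≈ᶻ-Reasoning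

  lincomb-partner : ∀ y₁ y₂ α β i j → ⟨ x , y₁ ⟩ ≡ ι α ℚ.* r → ⟨ x , y₂ ⟩ ≡ ι β ℚ.* r →
                    d ∣ i ℤ.* α ℤ.+ j ℤ.* β ℤ.- + 1 → ⟨ x , lincomb i j y₁ y₂ ⟩ ≈ᶻ r
  lincomb-partner y₁ y₂ α β i j ⟨x,y₁⟩≡α/d ⟨x,y₂⟩≡β/d d∣iα+jβ-1 = begin
    ⟨ x , lincomb i j y₁ y₂ ⟩                       ≡⟨ ⟨⟩-lincombʳ x i j y₁ y₂ ⟩
    ι i ℚ.* ⟨ x , y₁ ⟩ ℚ.+ ι j ℚ.* ⟨ x , y₂ ⟩       ≡⟨ cong₂ (λ p q → ι i ℚ.* p ℚ.+ ι j ℚ.* q) ⟨x,y₁⟩≡α/d ⟨x,y₂⟩≡β/d ⟩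
    ι i ℚ.* (ι α ℚ.* r) ℚ.+ ι j ℚ.* (ι β ℚ.* r)     ≡⟨ collect (ι i) (ι α) (ι j) (ι β) r ⟩
    (ι i ℚ.* ι α ℚ.+ ι j ℚ.* ι β) ℚ.* r             ≡⟨ cong (ℚ._* r) ι[iα+jβ] ⟨
    ι (i ℤ.* α ℤ.+ j ℤ.* β) ℚ.* r                   ≈⟨ ∣⇒*recip≈ᶻ m {i ℤ.* α ℤ.+ j ℤ.* β} {+ 1} d∣iα+jβ-1 ⟩
    ι (+ 1) ℚ.* r                                   ≡⟨ ℚ.*-identityˡ r ⟩
    r                                               ∎
    where
    open ≈ᶻ-Reasoning
    collect : ∀ a b c e r → a ℚ.* (b ℚ.* r) ℚ.+ c ℚ.* (e ℚ.* r) ≡ (a ℚ.* b ℚ.+ c ℚ.* e) ℚ.* r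
    collect = solve-∀ ℚ-ring
    ι[iα+jβ] : ι (i ℤ.* α ℤ.+ j ℤ.* β) ≡ ι i ℚ.* ι α ℚ.+ ι j ℚ.* ι β
    ι[iα+jβ] = trans (ι-+ (i ℤ.* α) (j ℤ.* β)) (cong₂ ℚ._+_ (ι-* i α) (ι-* j β))

  partner-from-generators :
    ∀ y₁ y₂ → InDual L y₁ → InDual L y₂ → (d ·ᵥ y₁) ≋ 0ᵥ → (d ·ᵥ y₂) ≋ 0ᵥ →
    (∀ k → ⟨ (+ k) ·ᵥ x , y₁ ⟩ ≈ᶻ 0ℚ → ⟨ (+ k) ·ᵥ x , y₂ ⟩ ≈ᶻ 0ℚ → ((+ k) ·ᵥ x) ≋ 0ᵥ) →
    C4
  partner-from-generators y₁ y₂ y₁-dual y₂-dual dy₁≋0 dy₂≋0 kx⊥⇒kx≋0 =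
    from-pairings (⟨⟩-torsion m x y₁ x-dual dy₁≋0) (⟨⟩-torsion m x y₂ x-dual dy₂≋0)
    where
    from-pairings : ∃[ α ] ⟨ x , y₁ ⟩ ≡ ι α ℚ.* r → ∃[ β ] ⟨ x , y₂ ⟩ ≡ ι β ℚ.* r → C4
    from-pairings (α , ⟨x,y₁⟩≡α/d) (β , ⟨x,y₂⟩≡β/d) =
      from-combination (gcd₃≡1⇒combination (suc m) α β (no-proper-multiple⇒gcd₃≡1 m α β no-proper-multiple))
      where
      no-proper-multiple : ∀ k → 1 ℕ.≤ k → k ℕ.< suc m → d ∣ + k ℤ.* α → d ∣ + k ℤ.* β → ⊥
      no-proper-multiple k 1≤k k<d d∣kα d∣kβ = proj₂ (proj₂ x-order) k 1≤k k<d
        (≋⇒≈ (kx⊥⇒kx≋0 k (multiple-⊥ k α y₁ ⟨x,y₁⟩≡α/d d∣kα) (multiple-⊥ k β y₂ ⟨x,y₂⟩≡β/d d∣kβ)))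
      from-combination : (∃₂ λ i j → d ∣ i ℤ.* α ℤ.+ j ℤ.* β ℤ.- + 1) → C4
      from-combination (i , j , d∣iα+jβ-1) =
        lincomb i j y₁ y₂ , dual-lincomb i j {y₁} {y₂} y₁-dual y₂-dual ,
        partner-order (lincomb i j y₁ y₂) (lincomb-torsion d i j dy₁≋0 dy₂≋0) ⟨x,y⟩≈ᶻ1/d , integral ⟨x,y⟩≈ᶻ1/d
        where
        ⟨x,y⟩≈ᶻ1/d : ⟨ x , lincomb i j y₁ y₂ ⟩ ≈ᶻ r
        ⟨x,y⟩≈ᶻ1/d = lincomb-partner y₁ y₂ α β i j ⟨x,y₁⟩≡α/d ⟨x,y₂⟩≡β/d d∣iα+jβ-1

  c1⇒c2 : C1 → C2
  c1⇒c2 (D₁ , x∈D₁ , iso , _ , span∩perp) =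
    D₁ , x∈D₁ , iso , λ v v∈D₁ v⊥D₁ → span∩perp v v∈D₁ (Subgroup.⊆dual D₁ v v∈D₁ , v⊥D₁)

  c2⇒c4 : C2 → C4
  c2⇒c4 (D₁ , x∈D₁ , (f , f∈D₁ , f-additive , f-descends , _ , f-onto) , nondegenerate) =
    partner-from-generators y₁ y₂ (⊆dual y₁ (f∈D₁ (+ 1) (+ 0))) (⊆dual y₂ (f∈D₁ (+ 0) (+ 1)))
      -- the quotients 1 and 0 witness d ∣ d − 0 and d ∣ 0 − 0 in the unsigned divisibility of IsoZmod²
      (≋-trans (≗⇒≋ (·ᵥ-as-lincombˡ d y₁ y₂)) (multiple≋0 d (+ 0) (ℕ.divides 1 refl) (ℕ.divides 0 refl)))
      (≋-trans (≗⇒≋ (·ᵥ-as-lincombʳ d y₁ y₂)) (multiple≋0 (+ 0) d (ℕ.divides 0 refl) (ℕ.divides 1 refl)))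
      kx⊥⇒kx≋0
    where
    open Subgroup D₁
    y₁ y₂ : Vecℚ n
    y₁ = f (+ 1) (+ 0)
    y₂ = f (+ 0) (+ 1)
    f≋lincomb : ∀ i j → f i j ≋ lincomb i j y₁ y₂
    f≋lincomb = biadditive⇒lincomb f (λ i j i′ j′ → ≈⇒≋ {f (i ℤ.+ i′) (j ℤ.+ j′)} (f-additive i j i′ j′))
    multiple≋0 : ∀ i j → (+ suc m) Unsigned.∣ (i ℤ.- + 0) → (+ suc m) Unsigned.∣ (j ℤ.- + 0) → lincomb i j y₁ y₂ ≋ 0ᵥ
    multiple≋0 i j d∣i d∣j =
      ≋-trans (≋-sym (f≋lincomb i j)) (≋-trans (≈⇒≋ {f i j} (f-descends i j (+ 0) (+ 0) d∣i d∣j))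
        (≋-trans (f≋lincomb (+ 0) (+ 0)) (≗⇒≋ (lincomb-zero y₁ y₂))))
    kx⊥⇒kx≋0 : ∀ k → ⟨ (+ k) ·ᵥ x , y₁ ⟩ ≈ᶻ 0ℚ → ⟨ (+ k) ·ᵥ x , y₂ ⟩ ≈ᶻ 0ℚ → ((+ k) ·ᵥ x) ≋ 0ᵥ
    kx⊥⇒kx≋0 k kx⊥y₁ kx⊥y₂ = ≈⇒≋ {(+ k) ·ᵥ x} (nondegenerate kx kx∈D₁ kx⊥D₁)
      where
      kx : Vecℚ n
      kx = (+ k) ·ᵥ x
      kx∈D₁ : Mem kx
      kx∈D₁ = ℕ-multiple-∈ D₁ k x∈D₁
      kx⊥D₁ : ∀ w → Mem w → IsInt ⟨ kx , w ⟩
      kx⊥D₁ w w∈D₁ =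
        let (i , j , w≈fij) = f-onto w w∈D₁
        in ≈ᶻ0⇒isInt (≈ᶻ-trans (⟨⟩-congʳ-≋ kx (⊆dual kx kx∈D₁) (≋-trans (≈⇒≋ {w} w≈fij) (f≋lincomb i j)))
                              (⟨⟩-lincomb-≈ᶻ0 kx i j y₁ y₂ kx⊥y₁ kx⊥y₂))

  c3⇒c4 : C3 → C4
  c3⇒c4 (y , y-dual , _ , span∩perp) = partner-from-generators x y x-dual y-dual dx≋0 dy≋0 kx⊥⇒kx≋0
    where
    open Span {x} {y} x-dual y-dual
    vanish : ∀ u i j → u ≋ lincomb i j x y → ⟨ u , x ⟩ ≈ᶻ 0ℚ → ⟨ u , y ⟩ ≈ᶻ 0ℚ → u ≋ 0ᵥ
    vanish u i j u≋lc u⊥x u⊥y = ≈⇒≋ {u} (span∩perp u u∈span (span-perp u (proj₁ u∈span) u⊥x u⊥y))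
      where
      u∈span : Gen L x y u
      u∈span = lincomb-∈ i j u≋lc
    dy≋0 : (d ·ᵥ y) ≋ 0ᵥ
    dy≋0 = vanish (d ·ᵥ y) (+ 0) d (≗⇒≋ (·ᵥ-as-lincombʳ d x y)) dy⊥x dy⊥y
      where
      open ≈ᶻ-Reasoning
      dy⊥x : ⟨ d ·ᵥ y , x ⟩ ≈ᶻ 0ℚ
      dy⊥x = begin
        ⟨ d ·ᵥ y , x ⟩          ≡⟨ ⟨⟩-·ˡ x d y ⟩
        ι d ℚ.* ⟨ y , x ⟩       ≡⟨ ⟨⟩-·ʳ y d x ⟨
        ⟨ y , d ·ᵥ x ⟩          ≈⟨ ⟨⟩-congʳ-≋ y y-dual dx≋0 ⟩
        ⟨ y , 0ᵥ ⟩              ≡⟨ ⟨⟩-0ʳ y ⟩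
        0ℚ                      ∎
      dy⊥y : ⟨ d ·ᵥ y , y ⟩ ≈ᶻ 0ℚ
      dy⊥y = ≈ᶻ-reflexive (trans (⟨⟩-·ˡ y d y) (trans (cong (ι d ℚ.*_) (⟨⟩-self y)) (ℚ.*-zeroʳ (ι d))))
    kx⊥⇒kx≋0 : ∀ k → ⟨ (+ k) ·ᵥ x , x ⟩ ≈ᶻ 0ℚ → ⟨ (+ k) ·ᵥ x , y ⟩ ≈ᶻ 0ℚ → ((+ k) ·ᵥ x) ≋ 0ᵥ
    kx⊥⇒kx≋0 k = vanish ((+ k) ·ᵥ x) (+ k) (+ 0) (≗⇒≋ (·ᵥ-as-lincombˡ (+ k) x y))

  c4⇒c1 : C4 → C1
  c4⇒c1 (y , y-dual , y-order , ⟨x,y⟩-1/d∈ℤ) = span , x∈span , span-iso , span-directSum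
    where
    open Span {x} {y} x-dual y-dual
    open HyperbolicPair L m x-dual y-dual dx≋0 (≈⇒≋ {d ·ᵥ y} (proj₁ (proj₂ y-order))) (mod1 ⟨x,y⟩-1/d∈ℤ)

  c4⇒c3 : C4 → C3
  c4⇒c3 (y , y-dual , y-order , ⟨x,y⟩-1/d∈ℤ) = y , y-dual , span-directSum
    where
    open HyperbolicPair L m x-dual y-dual dx≋0 (≈⇒≋ {d ·ᵥ y} (proj₁ (proj₂ y-order))) (mod1 ⟨x,y⟩-1/d∈ℤ)

lemma3p1 : ∀ {n : ℕ} (L : SymplecticLattice n) (x : Vecℚ n) (d : ℕ) →
    InDual L x → HasOrder L x d →
    let C1 = ∃[ D₁ ] (Subgroup.Mem D₁ x × IsoZmod² L d D₁
                      × DirectSumWithPerp L (Subgroup.Mem D₁))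
        C2 = ∃[ D₁ ] (Subgroup.Mem D₁ x × IsoZmod² L d D₁
                      × NondegOn L (Subgroup.Mem D₁))
        C3 = ∃[ y ] (InDual L y × DirectSumWithPerp L (Gen L x y))
        C4 = ∃[ y ] (InDual L y × HasOrder L y d
                     × IsInt (⟪_,_⟫ L x y - recip d))
    in (C1 ⇔ C2) × (C1 ⇔ C3) × (C1 ⇔ C4)
lemma3p1 L x zero    x-dual (() , _)
lemma3p1 L x (suc m) x-dual x-order =
    mk⇔ c1⇒c2 (c4⇒c1 ∘ c2⇒c4)
  , mk⇔ (c4⇒c3 ∘ c2⇒c4 ∘ c1⇒c2) (c4⇒c1 ∘ c3⇒c4)
  , mk⇔ (c2⇒c4 ∘ c1⇒c2) c4⇒c1
  where open Partner L m x-dual x-order
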